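{- Let $n,k,t,r$ be positive integers with $r\geq 3$, $t+r-2\leq k-2$ and $2k+t+r+2\leq n$. Let $X\subseteq M\subseteq C\subseteq[n]$ with $|X|=t+r-2$, $|M|=k$ and $|C|=c\in\{k+2,k+3,\dots,2k-t-r+2\}$. Let $\mathcal{F}$ be a non-trivial $r$-wise $t$-intersecting subfamily of $\mathcal{H}_1(X,M,C)$. If $|\mathcal{F}|>h_1(t+r-2,k,n)$, then $\mathcal{F}\subseteq\mathcal{H}(k,t+r-1,X,M')$ for some $(k+1)$-subset $M'$ of $C$ with $M\subseteq M'$.
   Context: $[n]=\{1,\dots,n\}$; $\binom{V}{k}$ is the family of $k$-subsets of $V$. A family $\mathcal{F}\subseteq\binom{[n]}{k}$ is $r$-wise $t$-intersecting if $|F_1\cap\cdots\cap F_r|\geq t$ for all $F_1,\dots,F_r\in\mathcal{F}$; it is trivial if all its members contain a common $t$-subset of $[n]$, and non-trivial otherwise. Write $d=t+r-2=|X|$. Then $\mathcal{H}_1(X,M,C)=\mathcal{E}_1\cup\mathcal{E}_2\cup\mathcal{E}_3$, where $\mathcal{E}_1=\{F\in\binom{[n]}{k}: X\subseteq F,\ |F\cap M|\geq d+1\}$, $\mathcal{E}_2=\{F\in\binom{[n]}{k}: F\cap M=X,\ |F\cap C|=c-k+d\}$, $\mathcal{E}_3=\{F\in\binom{C}{k}: |F\cap X|=d-1,\ |F\cap M|=k-1\}$. For $M'\in\binom{[n]}{k+1}$ with $X\subseteq M'$: $\mathcal{H}(k,d+1,X,M')=\{H\in\binom{[n]}{k}: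 X\subseteq H,\ |H\cap M'|\geq d+1\}\cup\binom{M'}{k}$. $h_1(d,k,c)=\binom{n-d}{k-d}-\binom{n-k}{k-d}+\binom{n-c}{2k-c-d}+d(c-k)$, with $\binom{a}{b}=0$ when $b<0$ or $b>a$ (so $h_1(d,k,n)=\binom{n-d}{k-d}-\binom{n-k}{k-d}+d(n-k)$ for $n\geq 2k$). -}

module Defs where

open import Data.Nat using (ℕ; _+_; _*_; _∸_; _≤_; _<_)
open import Data.Nat.Combinatorics using () renaming (_C_ to _choose_)
open import Data.Fin using (Fin)
open import Data.Fin.Subset using (Subset; _⊆_; _∩_; ⋂; ∣_∣)
open import Data.List using (List; tabulate)
open import Data.List.Membership.Propositional using () renaming (_∈_ to _∈ᶠ_)
open import Data.Product using (Σ; _×_; ∃)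
open import Data.Sum using (_⊎_)
open import Relation.Binary.PropositionalEquality using (_≡_)
open import Relation.Nullary using (¬_)

-- A family of subsets of [n] is a duplicate-free list of subsets
-- (duplicate-freeness is imposed in the statement via Unique).
Family : ℕ → Set
Family n = List (Subset n)

Uniform : {n : ℕ} → ℕ → Family n → Set
Uniform k 𝓕 = ∀ F → F ∈ᶠ 𝓕 → ∣ F ∣ ≡ k

-- r-wise t-intersecting: any r (not necessarily distinct) members meet in ≥ t points
RWiseTIntersecting : {n : ℕ} → ℕ → ℕ → Family n → Set
RWiseTIntersecting {n} r t 𝓕 =
  (G : Fin r → Subset n) → (∀ i → G i ∈ᶠ 𝓕) → t ≤ ∣ ⋂ (tabulate G) ∣

Trivial : {n : ℕ} → ℕ → Family n → Set
Trivial {n} t 𝓕 = Σ (Subset n) λ T → ∣ T ∣ ≡ t × (∀ F → F ∈ᶠ 𝓕 → T ⊆ F)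

NonTrivial : {n : ℕ} → ℕ → Family n → Set
NonTrivial t 𝓕 = ¬ Trivial t 𝓕

InE₁ : {n : ℕ} → ℕ → ℕ → Subset n → Subset n → Subset n → Set
InE₁ k d X M F = ∣ F ∣ ≡ k × X ⊆ F × (1 + d) ≤ ∣ F ∩ M ∣

InE₂ : {n : ℕ} → ℕ → ℕ → ℕ → Subset n → Subset n → Subset n → Subset n → Set
InE₂ k d c X M C F = ∣ F ∣ ≡ k × F ∩ M ≡ X × ∣ F ∩ C ∣ ≡ (c ∸ k) + d

InE₃ : {n : ℕ} → ℕ → ℕ → Subset n → Subset n → Subset n → Subset n → Set
InE₃ k d X M C F = ∣ F ∣ ≡ k × F ⊆ C × ∣ F ∩ X ∣ ≡ d ∸ 1 × ∣ F ∩ M ∣ ≡ k ∸ 1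

InH₁ : {n : ℕ} → ℕ → Subset n → Subset n → Subset n → Subset n → Set
InH₁ k X M C F =
  InE₁ k (∣ X ∣) X M F ⊎ InE₂ k (∣ X ∣) (∣ C ∣) X M C F ⊎ InE₃ k (∣ X ∣) X M C F

InH : {n : ℕ} → ℕ → ℕ → Subset n → Subset n → Subset n → Set
InH k s X M′ H = ∣ H ∣ ≡ k × ((X ⊆ H × s ≤ ∣ H ∩ M′ ∣) ⊎ H ⊆ M′)

-- h₁(d,k,n) = C(n-d,k-d) - C(n-k,k-d) + d(n-k)   (the first term dominates, so ∸ is exact)
h₁ : ℕ → ℕ → ℕ → ℕ
h₁ d k n = ((n ∸ d) choose (k ∸ d) ∸ (n ∸ k) choose (k ∸ d)) + d * (n ∸ k)

module Submission where

-- Every member of H₁(X,M,C) contains X except the E₃-sets, which have the form (M - x) ∪ {y} with a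
-- missing point x ∈ X and an extra point y ∈ C ∖ M.  If 𝓕 has no E₂-member, then 𝓕 together with the
-- C(n-k,k-d) k-sets meeting M exactly in X (none of which lies in 𝓕) fits into the k-sets containing X
-- plus the d(n-k) sets (M - x) ∪ {y}, so |𝓕| ≤ h₁.  Hence some G₀ ∈ 𝓕 has G₀ ∩ M = X, and then
-- C ∖ M ⊆ G₀.  If two E₃-members had different extra points, either r - 1 E₃-members with distinct
-- missing points, two of them with different extra points, meet G₀ in at most |X| - (r - 1) = t - 1
-- points, or at most r - 2 missing points occur and X minus them is a common t-set; both are excluded.
-- So all E₃-members share one extra point y, and M' = M ∪ {y} works.

open import Defs
open import Data.Nat using (ℕ; _+_; _*_; _∸_; _≤_; _<_)
open import Data.List using (length)
open import Data.Fin.Subset using (Subset; _⊆_; ∣_∣)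
open import Data.List.Membership.Propositional using () renaming (_∈_ to _∈ᶠ_)
open import Data.List.Relation.Unary.Unique.Propositional using (Unique)
open import Data.Product using (Σ; _×_)
open import Relation.Binary.PropositionalEquality using (_≡_)

open import Data.Nat using (zero; suc; z≤n; s≤s; s≤s⁻¹)
open import Data.Nat.Properties
open import Data.Bool using (Bool; true; false)
open import Data.Empty using (⊥-elim)
open import Data.Fin using (Fin; zero; suc)
open import Data.Fin.Subset using (_∈_; _∉_; _∩_; _∪_; ∁; ⊥; ⁅_⁆; _-_; ⋂)
open import Data.Fin.Subset.Properties
open import Data.Vec using (Vec; []; _∷_; here; there)
open import Data.List using (List; []; _∷_; _++_; map; take; deduplicate; lookup)
open import Data.List.Properties using (length-++; length-map; length-take; filter-accept; tabulate-lookup)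
open import Data.List.Membership.Propositional.Properties using (∈-lookup; ∈-∃++; ∈-++⁻; ∈-++⁺ˡ; ∈-++⁺ʳ; ∈-map⁺; ∈-map⁻)
open import Data.List.Relation.Unary.Any using (Any; here; there)
open import Data.List.Membership.Propositional using (find)
open import Data.List.Relation.Unary.All using (All; []; _∷_)
open import Data.List.Relation.Unary.AllPairs using (AllPairs; []; _∷_)
open import Data.Product using (∃; ∃₂; _,_; proj₁; proj₂)
open import Data.Sum using (_⊎_; inj₁; inj₂)
open import Function using (_∘_)
open import Relation.Binary.PropositionalEquality using (_≢_; refl; sym; trans; cong; cong₂; subst; subst₂; module ≡-Reasoning)
open import Relation.Nullary using (¬_; Dec; yes; no; ¬?)
open import Relation.Nullary.Decidable using (decidable-stable)
open import Relation.Binary using (Decidable)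

import Data.List.Relation.Unary.All as All
import Data.List.Relation.Unary.Any as Any
import Data.List.Relation.Unary.All.Properties as Allₚ
import Data.List.Relation.Unary.Any.Properties as Anyₚ
import Data.List.Relation.Unary.AllPairs.Properties as AllPairsₚ
import Data.List.Relation.Unary.Unique.Propositional.Properties as Uniqueₚ
open import Data.Nat.Combinatorics using (nCk+nC[k+1]≡[n+1]C[k+1]; nCk≡nC[n∸k]; nC1≡n) renaming (_C_ to _choose_)
open import Data.Vec.Properties using (∷-injectiveʳ)

private
  variable
    A : Set
    n : ℕ

Unique∧⊆⇒length≤ : (xs ys : List A) → Unique xs → (∀ {z} → z ∈ᶠ xs → z ∈ᶠ ys) →
                    length xs ≤ length ys
Unique∧⊆⇒length≤ [] ys _ _ = z≤n
Unique∧⊆⇒length≤ (x ∷ xs) ys uxs@(_ ∷ uxs′) xs⊆ys with ∈-∃++ (xs⊆ys (here refl))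
... | us , vs , refl = begin
  suc (length xs)             ≤⟨ s≤s (Unique∧⊆⇒length≤ xs (us ++ vs) uxs′ xs⊆us++vs) ⟩
  suc (length (us ++ vs))     ≡⟨ cong suc (length-++ us) ⟩
  suc (length us + length vs) ≡⟨ +-suc (length us) (length vs) ⟨
  length us + length (x ∷ vs) ≡⟨ length-++ us ⟨
  length (us ++ x ∷ vs)       ∎
  where
    open ≤-Reasoning
    xs⊆us++vs : ∀ {z} → z ∈ᶠ xs → z ∈ᶠ us ++ vs
    xs⊆us++vs {z} z∈xs with ∈-++⁻ us (xs⊆ys (there z∈xs))
    ... | inj₁ z∈us = ∈-++⁺ˡ z∈us
    ... | inj₂ (here refl) = ⊥-elim (Uniqueₚ.Unique[x∷xs]⇒x∉xs uxs z∈xs)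
    ... | inj₂ (there z∈vs) = ∈-++⁺ʳ us z∈vs

module _ {R : A → A → Set} (R? : Decidable R) where

  deduplicate-AllPairs : (xs : List A) → AllPairs (λ a b → ¬ R a b) (deduplicate R? xs)
  deduplicate-AllPairs [] = []
  deduplicate-AllPairs (x ∷ xs) =
    Allₚ.all-filter (¬? ∘ R? x) (deduplicate R? xs) ∷ AllPairsₚ.filter⁺ _ (deduplicate-AllPairs xs)

  deduplicate-∷-∷ : ∀ {a b} xs → ¬ R a b → ∃ λ rest → deduplicate R? (a ∷ b ∷ xs) ≡ a ∷ b ∷ rest
  deduplicate-∷-∷ {a} {b} xs ¬Rab = _ , cong (a ∷_) (filter-accept (¬? ∘ R? a) ¬Rab)

middle⊎sides : {P Q R : A → Set} (xs : List A) → (∀ x → x ∈ᶠ xs → P x ⊎ Q x ⊎ R x) →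
               (∃ λ x → x ∈ᶠ xs × Q x) ⊎ (∀ x → x ∈ᶠ xs → P x ⊎ R x)
middle⊎sides [] _ = inj₂ λ _ ()
middle⊎sides (x ∷ xs) PQR with PQR x (here refl) | middle⊎sides xs (λ y → PQR y ∘ there)
... | _ | inj₁ (y , y∈xs , Qy) = inj₁ (y , there y∈xs , Qy)
... | inj₂ (inj₁ Qx) | inj₂ _ = inj₁ (x , here refl , Qx)
... | inj₁ Px | inj₂ PR = inj₂ λ { y (here refl) → inj₁ Px ; y (there y∈xs) → PR y y∈xs }
... | inj₂ (inj₂ Rx) | inj₂ PR = inj₂ λ { y (here refl) → inj₂ Rx ; y (there y∈xs) → PR y y∈xs }

∣p∣≡∣p∩q∣+∣p∩∁q∣ : (p q : Subset n) → ∣ p ∣ ≡ ∣ p ∩ q ∣ + ∣ p ∩ ∁ q ∣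
∣p∣≡∣p∩q∣+∣p∩∁q∣ [] [] = refl
∣p∣≡∣p∩q∣+∣p∩∁q∣ (true ∷ p) (true ∷ q) = cong suc (∣p∣≡∣p∩q∣+∣p∩∁q∣ p q)
∣p∣≡∣p∩q∣+∣p∩∁q∣ (true ∷ p) (false ∷ q) =
  trans (cong suc (∣p∣≡∣p∩q∣+∣p∩∁q∣ p q)) (sym (+-suc _ _))
∣p∣≡∣p∩q∣+∣p∩∁q∣ (false ∷ p) (true ∷ q) = ∣p∣≡∣p∩q∣+∣p∩∁q∣ p q
∣p∣≡∣p∩q∣+∣p∩∁q∣ (false ∷ p) (false ∷ q) = ∣p∣≡∣p∩q∣+∣p∩∁q∣ p q

q⊆p⇒p∩q≡q : {p q : Subset n} → q ⊆ p → p ∩ q ≡ q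
q⊆p⇒p∩q≡q {p = p} {q} q⊆p = ⊆-antisym (p∩q⊆q p q) (λ x∈q → x∈p∩q⁺ (q⊆p x∈q , x∈q))

p⊆q∧∣q∣≤∣p∣⇒q⊆p : (p q : Subset n) → p ⊆ q → ∣ q ∣ ≤ ∣ p ∣ → q ⊆ p
p⊆q∧∣q∣≤∣p∣⇒q⊆p [] [] _ _ ()
p⊆q∧∣q∣≤∣p∣⇒q⊆p (true ∷ p) (true ∷ q) _ _ here = here
p⊆q∧∣q∣≤∣p∣⇒q⊆p (true ∷ p) (true ∷ q) p⊆q ∣q∣≤∣p∣ (there x∈q) =
  there (p⊆q∧∣q∣≤∣p∣⇒q⊆p p q (drop-∷-⊆ p⊆q) (s≤s⁻¹ ∣q∣≤∣p∣) x∈q)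
p⊆q∧∣q∣≤∣p∣⇒q⊆p (false ∷ p) (false ∷ q) p⊆q ∣q∣≤∣p∣ (there x∈q) =
  there (p⊆q∧∣q∣≤∣p∣⇒q⊆p p q (drop-∷-⊆ p⊆q) ∣q∣≤∣p∣ x∈q)
p⊆q∧∣q∣≤∣p∣⇒q⊆p (true ∷ p) (false ∷ q) p⊆q _ _ with p⊆q here
... | ()
p⊆q∧∣q∣≤∣p∣⇒q⊆p (false ∷ p) (true ∷ q) p⊆q ∣q∣≤∣p∣ _ =
  ⊥-elim (<⇒≱ (s≤s (p⊆q⇒∣p∣≤∣q∣ (drop-∷-⊆ p⊆q))) ∣q∣≤∣p∣)

_∖_≐⁅_⁆ : Subset n → Subset n → Fin n → Set
q ∖ p ≐⁅ x ⁆ = x ∈ q × x ∉ p × (∀ {z} → z ∈ q → z ≢ x → z ∈ p)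

private
  ∖≐⁅⁆-∷ : (s : Bool) {p q : Subset n} {x : Fin n} → q ∖ p ≐⁅ x ⁆ → (s ∷ q) ∖ (s ∷ p) ≐⁅ suc x ⁆
  ∖≐⁅⁆-∷ _ {p} {q} {x} (x∈q , x∉p , rest) = there x∈q , x∉p ∘ drop-there , rest′
    where
      rest′ : ∀ {s z} → z ∈ s ∷ q → z ≢ suc x → z ∈ s ∷ p
      rest′ here _ = here
      rest′ (there z∈q) z≢sx = there (rest z∈q (z≢sx ∘ cong suc))

∃-∖≐⁅⁆ : (p q : Subset n) → p ⊆ q → suc ∣ p ∣ ≡ ∣ q ∣ → ∃ (q ∖ p ≐⁅_⁆)
∃-∖≐⁅⁆ [] [] _ ()
∃-∖≐⁅⁆ (true ∷ p) (true ∷ q) p⊆q eq =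
  let x , q∖p≐x = ∃-∖≐⁅⁆ p q (drop-∷-⊆ p⊆q) (suc-injective eq) in suc x , ∖≐⁅⁆-∷ true q∖p≐x
∃-∖≐⁅⁆ (false ∷ p) (false ∷ q) p⊆q eq =
  let x , q∖p≐x = ∃-∖≐⁅⁆ p q (drop-∷-⊆ p⊆q) eq in suc x , ∖≐⁅⁆-∷ false q∖p≐x
∃-∖≐⁅⁆ (true ∷ p) (false ∷ q) p⊆q _ with p⊆q here
... | ()
∃-∖≐⁅⁆ (false ∷ p) (true ∷ q) p⊆q eq = zero , here , (λ ()) , rest
  where
    q⊆p : q ⊆ p
    q⊆p = p⊆q∧∣q∣≤∣p∣⇒q⊆p p q (drop-∷-⊆ p⊆q) (≤-reflexive (sym (suc-injective eq)))
    rest : ∀ {z} → z ∈ true ∷ q → z ≢ zero → z ∈ false ∷ p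
    rest here z≢0 = ⊥-elim (z≢0 refl)
    rest (there z∈q) _ = there (q⊆p z∈q)

∖≐⁅⁆⇒≡ : {p q : Subset n} {x z : Fin n} → q ∖ p ≐⁅ x ⁆ → z ∈ q → z ∉ p → z ≡ x
∖≐⁅⁆⇒≡ {z = z} (_ , _ , rest) z∈q z∉p with z Data.Fin.≟ _
... | yes z≡x = z≡x
... | no z≢x = ⊥-elim (z∉p (rest z∈q z≢x))

∖≐⁅⁆⇒⊆∪⁅⁆ : {p q : Subset n} {x : Fin n} → q ∖ p ≐⁅ x ⁆ → q ⊆ p ∪ ⁅ x ⁆
∖≐⁅⁆⇒⊆∪⁅⁆ {p = p} {x = x} (_ , _ , rest) {z} z∈q with z Data.Fin.≟ x
... | yes refl = q⊆p∪q p ⁅ x ⁆ (x∈⁅x⁆ x)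
... | no z≢x = p⊆p∪q ⁅ x ⁆ (rest z∈q z≢x)

q∖[p∩q]⇒q∖p : {p q : Subset n} {x : Fin n} → q ∖ (p ∩ q) ≐⁅ x ⁆ → q ∖ p ≐⁅ x ⁆
q∖[p∩q]⇒q∖p {p = p} {q} (x∈q , x∉p∩q , rest) =
  x∈q , (λ x∈p → x∉p∩q (x∈p∩q⁺ (x∈p , x∈q))) , (λ z∈q z≢x → proj₁ (x∈p∩q⁻ p q (rest z∈q z≢x)))

q∖[q∩p]⇒q∖p : {p q : Subset n} {x : Fin n} → q ∖ (q ∩ p) ≐⁅ x ⁆ → q ∖ p ≐⁅ x ⁆
q∖[q∩p]⇒q∖p {p = p} {q} (x∈q , x∉q∩p , rest) =
  x∈q , (λ x∈p → x∉q∩p (x∈p∩q⁺ (x∈q , x∈p))) , (λ z∈q z≢x → proj₂ (x∈p∩q⁻ q p (rest z∈q z≢x)))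

∃-⊆-of-size : (p : Subset n) (t : ℕ) → t ≤ ∣ p ∣ → ∃ λ q → q ⊆ p × ∣ q ∣ ≡ t
∃-⊆-of-size {n} p zero _ = ⊥ , ⊥⊆ , ∣⊥∣≡0 n
∃-⊆-of-size (true ∷ p) (suc t) t<∣p∣ =
  let q , q⊆p , ∣q∣≡t = ∃-⊆-of-size p t (s≤s⁻¹ t<∣p∣) in true ∷ q , in⊆in q⊆p , cong suc ∣q∣≡t
∃-⊆-of-size (false ∷ p) (suc t) t<∣p∣ =
  let q , q⊆p , ∣q∣≡t = ∃-⊆-of-size p (suc t) t<∣p∣ in false ∷ q , out⊆ q⊆p , ∣q∣≡t

x∉p⇒∣p∪⁅x⁆∣≡1+∣p∣ : (p : Subset n) (x : Fin n) → x ∉ p → ∣ p ∪ ⁅ x ⁆ ∣ ≡ suc ∣ p ∣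
x∉p⇒∣p∪⁅x⁆∣≡1+∣p∣ (true ∷ p) zero x∉p = ⊥-elim (x∉p here)
x∉p⇒∣p∪⁅x⁆∣≡1+∣p∣ (false ∷ p) zero _ = cong (suc ∘ ∣_∣) (∪-identityʳ p)
x∉p⇒∣p∪⁅x⁆∣≡1+∣p∣ (true ∷ p) (suc x) x∉p = cong suc (x∉p⇒∣p∪⁅x⁆∣≡1+∣p∣ p x (x∉p ∘ there))
x∉p⇒∣p∪⁅x⁆∣≡1+∣p∣ (false ∷ p) (suc x) x∉p = x∉p⇒∣p∪⁅x⁆∣≡1+∣p∣ p x (x∉p ∘ there)

x∈p-y⇒x≢y : (p : Subset n) (y : Fin n) {x : Fin n} → x ∈ p - y → x ≢ y
x∈p-y⇒x≢y (_ ∷ p) (suc y) (there x∈p-y) refl = x∈p-y⇒x≢y p y x∈p-y refl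

x∈p⇒1+∣p-x∣≡∣p∣ : (p : Subset n) (x : Fin n) → x ∈ p → suc ∣ p - x ∣ ≡ ∣ p ∣
x∈p⇒1+∣p-x∣≡∣p∣ (true ∷ p) zero here = cong (suc ∘ ∣_∣) (p─⊥≡p p)
x∈p⇒1+∣p-x∣≡∣p∣ (true ∷ p) (suc x) (there x∈p) = cong suc (x∈p⇒1+∣p-x∣≡∣p∣ p x x∈p)
x∈p⇒1+∣p-x∣≡∣p∣ (false ∷ p) (suc x) (there x∈p) = x∈p⇒1+∣p-x∣≡∣p∣ p x x∈p

∣p∣≤1+∣p-x∣ : (p : Subset n) (x : Fin n) → ∣ p ∣ ≤ suc ∣ p - x ∣
∣p∣≤1+∣p-x∣ (true ∷ p) zero = s≤s (≤-reflexive (cong ∣_∣ (sym (p─⊥≡p p))))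
∣p∣≤1+∣p-x∣ (false ∷ p) zero = m≤n⇒m≤1+n (≤-reflexive (cong ∣_∣ (sym (p─⊥≡p p))))
∣p∣≤1+∣p-x∣ (true ∷ p) (suc x) = s≤s (∣p∣≤1+∣p-x∣ p x)
∣p∣≤1+∣p-x∣ (false ∷ p) (suc x) = ∣p∣≤1+∣p-x∣ p x

removeAll : Subset n → List (Fin n) → Subset n
removeAll p [] = p
removeAll p (x ∷ xs) = removeAll p xs - x

∈-removeAll⁻ : (p : Subset n) (xs : List (Fin n)) {z : Fin n} → z ∈ removeAll p xs → z ∈ p × ¬ z ∈ᶠ xs
∈-removeAll⁻ p [] z∈p = z∈p , λ ()
∈-removeAll⁻ p (x ∷ xs) z∈ =
  let z∈p , z∉xs = ∈-removeAll⁻ p xs (p─q⊆p (removeAll p xs) ⁅ x ⁆ z∈)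
  in z∈p , λ { (here refl) → x∈p-y⇒x≢y (removeAll p xs) x z∈ refl ; (there z∈xs) → z∉xs z∈xs }

∈-removeAll⁺ : (p : Subset n) (xs : List (Fin n)) {z : Fin n} → z ∈ p → ¬ z ∈ᶠ xs → z ∈ removeAll p xs
∈-removeAll⁺ p [] z∈p _ = z∈p
∈-removeAll⁺ p (x ∷ xs) z∈p z∉x∷xs =
  x∈p∧x≢y⇒x∈p-y (∈-removeAll⁺ p xs z∈p (z∉x∷xs ∘ there)) (λ { refl → z∉x∷xs (here refl) })

∣p∣≤∣removeAll∣+length : (p : Subset n) (xs : List (Fin n)) → ∣ p ∣ ≤ ∣ removeAll p xs ∣ + length xs
∣p∣≤∣removeAll∣+length p [] = ≤-reflexive (sym (+-identityʳ _))
∣p∣≤∣removeAll∣+length p (x ∷ xs) = begin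
  ∣ p ∣                                    ≤⟨ ∣p∣≤∣removeAll∣+length p xs ⟩
  ∣ removeAll p xs ∣ + length xs           ≤⟨ +-monoˡ-≤ (length xs) (∣p∣≤1+∣p-x∣ (removeAll p xs) x) ⟩
  suc ∣ removeAll p xs - x ∣ + length xs   ≡⟨ +-suc _ _ ⟨
  ∣ removeAll p xs - x ∣ + suc (length xs) ∎
  where open ≤-Reasoning

∣removeAll∣+length≡∣p∣ : (p : Subset n) (xs : List (Fin n)) → Unique xs → All (_∈ p) xs →
                         ∣ removeAll p xs ∣ + length xs ≡ ∣ p ∣
∣removeAll∣+length≡∣p∣ p [] _ _ = +-identityʳ _
∣removeAll∣+length≡∣p∣ p (x ∷ xs) uxs@(_ ∷ uxs′) (x∈p ∷ xs⊆p) = begin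
  ∣ removeAll p xs - x ∣ + suc (length xs) ≡⟨ +-suc _ _ ⟩
  suc ∣ removeAll p xs - x ∣ + length xs   ≡⟨ cong (_+ length xs) (x∈p⇒1+∣p-x∣≡∣p∣ _ x x∈p∖xs) ⟩
  ∣ removeAll p xs ∣ + length xs           ≡⟨ ∣removeAll∣+length≡∣p∣ p xs uxs′ xs⊆p ⟩
  ∣ p ∣                                    ∎
  where
    open ≡-Reasoning
    x∈p∖xs : x ∈ removeAll p xs
    x∈p∖xs = ∈-removeAll⁺ p xs x∈p (Uniqueₚ.Unique[x∷xs]⇒x∉xs uxs)

-- Enumerating subsets by roles

data Role : Set where
  required forbidden pool₁ pool₂ : Role

is : Role → Role → Bool
is required required = true
is forbidden forbidden = true
is pool₁ pool₁ = true
is pool₂ pool₂ = true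
is _ _ = false

assigned : Role → Vec Role n → Subset n
assigned ρ = Data.Vec.map (is ρ)

Fits : Vec Role n → ℕ → ℕ → Subset n → Set
Fits roles a b F = assigned required roles ⊆ F × (∀ {i} → i ∈ assigned forbidden roles → i ∉ F)
                 × ∣ F ∩ assigned pool₁ roles ∣ ≡ a × ∣ F ∩ assigned pool₂ roles ∣ ≡ b

enumerate : Vec Role n → ℕ → ℕ → List (Subset n)
enumerate [] zero zero = [] ∷ []
enumerate [] _ _ = []
enumerate (required ∷ roles) a b = map (true ∷_) (enumerate roles a b)
enumerate (forbidden ∷ roles) a b = map (false ∷_) (enumerate roles a b)
enumerate (pool₁ ∷ roles) zero b = map (false ∷_) (enumerate roles zero b)
enumerate (pool₁ ∷ roles) (suc a) b =
  map (false ∷_) (enumerate roles (suc a) b) ++ map (true ∷_) (enumerate roles a b)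
enumerate (pool₂ ∷ roles) a zero = map (false ∷_) (enumerate roles a zero)
enumerate (pool₂ ∷ roles) a (suc b) =
  map (false ∷_) (enumerate roles a (suc b)) ++ map (true ∷_) (enumerate roles a b)

-- Fits, unfolded one position at a time along the recursion of enumerate.
private
  FitsRec : Vec Role n → ℕ → ℕ → Subset n → Set
  FitsRec [] a b [] = a ≡ 0 × b ≡ 0
  FitsRec (required ∷ roles) a b (s ∷ F) = s ≡ true × FitsRec roles a b F
  FitsRec (forbidden ∷ roles) a b (s ∷ F) = s ≡ false × FitsRec roles a b F
  FitsRec (pool₁ ∷ roles) a b (false ∷ F) = FitsRec roles a b F
  FitsRec (pool₁ ∷ roles) a b (true ∷ F) = ∃ λ a′ → a ≡ suc a′ × FitsRec roles a′ b F
  FitsRec (pool₂ ∷ roles) a b (false ∷ F) = FitsRec roles a b F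
  FitsRec (pool₂ ∷ roles) a b (true ∷ F) = ∃ λ b′ → b ≡ suc b′ × FitsRec roles a b′ F

  Fits-tail : ∀ {s} ρ (roles : Vec Role n) {a b a′ b′} F → Fits (ρ ∷ roles) a b (s ∷ F) →
              ∣ F ∩ assigned pool₁ roles ∣ ≡ a′ → ∣ F ∩ assigned pool₂ roles ∣ ≡ b′ → Fits roles a′ b′ F
  Fits-tail _ roles F (req⊆ , forb , _) ∣p₁∣ ∣p₂∣ =
    drop-∷-⊆ req⊆ , (λ i∈ i∈F → forb (there i∈) (there i∈F)) , ∣p₁∣ , ∣p₂∣

  Fits⇒FitsRec : ∀ (roles : Vec Role n) a b F → Fits roles a b F → FitsRec roles a b F
  Fits⇒FitsRec [] a b [] (_ , _ , ∣p₁∣ , ∣p₂∣) = sym ∣p₁∣ , sym ∣p₂∣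
  Fits⇒FitsRec (required ∷ roles) a b (true ∷ F) fits@(_ , _ , ∣p₁∣ , ∣p₂∣) =
    refl , Fits⇒FitsRec roles a b F (Fits-tail required roles F fits ∣p₁∣ ∣p₂∣)
  Fits⇒FitsRec (required ∷ roles) a b (false ∷ F) (req⊆ , _) with req⊆ here
  ... | ()
  Fits⇒FitsRec (forbidden ∷ roles) a b (true ∷ F) (_ , forb , _) = ⊥-elim (forb here here)
  Fits⇒FitsRec (forbidden ∷ roles) a b (false ∷ F) fits@(_ , _ , ∣p₁∣ , ∣p₂∣) =
    refl , Fits⇒FitsRec roles a b F (Fits-tail forbidden roles F fits ∣p₁∣ ∣p₂∣)
  Fits⇒FitsRec (pool₁ ∷ roles) a b (false ∷ F) fits@(_ , _ , ∣p₁∣ , ∣p₂∣) =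
    Fits⇒FitsRec roles a b F (Fits-tail pool₁ roles F fits ∣p₁∣ ∣p₂∣)
  Fits⇒FitsRec (pool₁ ∷ roles) a b (true ∷ F) fits@(_ , _ , ∣p₁∣ , ∣p₂∣) =
    _ , sym ∣p₁∣ , Fits⇒FitsRec roles _ b F (Fits-tail pool₁ roles F fits refl ∣p₂∣)
  Fits⇒FitsRec (pool₂ ∷ roles) a b (false ∷ F) fits@(_ , _ , ∣p₁∣ , ∣p₂∣) =
    Fits⇒FitsRec roles a b F (Fits-tail pool₂ roles F fits ∣p₁∣ ∣p₂∣)
  Fits⇒FitsRec (pool₂ ∷ roles) a b (true ∷ F) fits@(_ , _ , ∣p₁∣ , ∣p₂∣) =
    _ , sym ∣p₂∣ , Fits⇒FitsRec roles a _ F (Fits-tail pool₂ roles F fits ∣p₁∣ refl)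

  FitsRec⇒Fits : ∀ (roles : Vec Role n) a b F → FitsRec roles a b F → Fits roles a b F
  FitsRec⇒Fits [] a b [] (refl , refl) = (λ i∈ → i∈) , (λ ()) , refl , refl
  FitsRec⇒Fits (required ∷ roles) a b (true ∷ F) (refl , rec) =
    let req⊆ , forb , ∣p₁∣ , ∣p₂∣ = FitsRec⇒Fits roles a b F rec
    in in⊆in req⊆ , (λ { (there i∈) (there i∈F) → forb i∈ i∈F }) , ∣p₁∣ , ∣p₂∣
  FitsRec⇒Fits (forbidden ∷ roles) a b (false ∷ F) (refl , rec) =
    let req⊆ , forb , ∣p₁∣ , ∣p₂∣ = FitsRec⇒Fits roles a b F rec
    in out⊆ req⊆ , (λ { here () ; (there i∈) (there i∈F) → forb i∈ i∈F }) , ∣p₁∣ , ∣p₂∣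
  FitsRec⇒Fits (pool₁ ∷ roles) a b (false ∷ F) rec =
    let req⊆ , forb , ∣p₁∣ , ∣p₂∣ = FitsRec⇒Fits roles a b F rec
    in out⊆ req⊆ , (λ { (there i∈) (there i∈F) → forb i∈ i∈F }) , ∣p₁∣ , ∣p₂∣
  FitsRec⇒Fits (pool₁ ∷ roles) a b (true ∷ F) (a′ , refl , rec) =
    let req⊆ , forb , ∣p₁∣ , ∣p₂∣ = FitsRec⇒Fits roles a′ b F rec
    in out⊆ req⊆ , (λ { (there i∈) (there i∈F) → forb i∈ i∈F }) , cong suc ∣p₁∣ , ∣p₂∣
  FitsRec⇒Fits (pool₂ ∷ roles) a b (false ∷ F) rec =
    let req⊆ , forb , ∣p₁∣ , ∣p₂∣ = FitsRec⇒Fits roles a b F rec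
    in out⊆ req⊆ , (λ { (there i∈) (there i∈F) → forb i∈ i∈F }) , ∣p₁∣ , ∣p₂∣
  FitsRec⇒Fits (pool₂ ∷ roles) a b (true ∷ F) (b′ , refl , rec) =
    let req⊆ , forb , ∣p₁∣ , ∣p₂∣ = FitsRec⇒Fits roles a b′ F rec
    in out⊆ req⊆ , (λ { (there i∈) (there i∈F) → forb i∈ i∈F }) , ∣p₁∣ , cong suc ∣p₂∣

  ∈-enumerate-rec⁺ : ∀ (roles : Vec Role n) a b F → FitsRec roles a b F → F ∈ᶠ enumerate roles a b
  ∈-enumerate-rec⁺ [] zero zero [] _ = here refl
  ∈-enumerate-rec⁺ (required ∷ roles) a b (_ ∷ F) (refl , rec) = ∈-map⁺ _ (∈-enumerate-rec⁺ roles a b F rec)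
  ∈-enumerate-rec⁺ (forbidden ∷ roles) a b (_ ∷ F) (refl , rec) = ∈-map⁺ _ (∈-enumerate-rec⁺ roles a b F rec)
  ∈-enumerate-rec⁺ (pool₁ ∷ roles) zero b (false ∷ F) rec = ∈-map⁺ _ (∈-enumerate-rec⁺ roles zero b F rec)
  ∈-enumerate-rec⁺ (pool₁ ∷ roles) (suc a) b (false ∷ F) rec =
    ∈-++⁺ˡ (∈-map⁺ _ (∈-enumerate-rec⁺ roles (suc a) b F rec))
  ∈-enumerate-rec⁺ (pool₁ ∷ roles) (suc a) b (true ∷ F) (_ , refl , rec) =
    ∈-++⁺ʳ _ (∈-map⁺ _ (∈-enumerate-rec⁺ roles a b F rec))
  ∈-enumerate-rec⁺ (pool₂ ∷ roles) a zero (false ∷ F) rec = ∈-map⁺ _ (∈-enumerate-rec⁺ roles a zero F rec)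
  ∈-enumerate-rec⁺ (pool₂ ∷ roles) a (suc b) (false ∷ F) rec =
    ∈-++⁺ˡ (∈-map⁺ _ (∈-enumerate-rec⁺ roles a (suc b) F rec))
  ∈-enumerate-rec⁺ (pool₂ ∷ roles) a (suc b) (true ∷ F) (_ , refl , rec) =
    ∈-++⁺ʳ _ (∈-map⁺ _ (∈-enumerate-rec⁺ roles a b F rec))

  ∈-map-∷⁻ : ∀ (P : Subset (suc n) → Set) {s : Bool} {xs : List (Subset n)} {G} →
             G ∈ᶠ map (s ∷_) xs → (∀ F → F ∈ᶠ xs → P (s ∷ F)) → P G
  ∈-map-∷⁻ _ G∈ h with ∈-map⁻ _ G∈
  ... | F , F∈ , refl = h F F∈

  ∈-enumerate-rec⁻ : ∀ (roles : Vec Role n) a b G → G ∈ᶠ enumerate roles a b → FitsRec roles a b G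
  ∈-enumerate-rec⁻ [] zero zero [] _ = refl , refl
  ∈-enumerate-rec⁻ (required ∷ roles) a b G G∈ =
    ∈-map-∷⁻ (FitsRec (required ∷ roles) a b) G∈ λ F F∈ → refl , ∈-enumerate-rec⁻ roles a b F F∈
  ∈-enumerate-rec⁻ (forbidden ∷ roles) a b G G∈ =
    ∈-map-∷⁻ (FitsRec (forbidden ∷ roles) a b) G∈ λ F F∈ → refl , ∈-enumerate-rec⁻ roles a b F F∈
  ∈-enumerate-rec⁻ (pool₁ ∷ roles) zero b G G∈ =
    ∈-map-∷⁻ (FitsRec (pool₁ ∷ roles) zero b) G∈ λ F F∈ → ∈-enumerate-rec⁻ roles zero b F F∈
  ∈-enumerate-rec⁻ (pool₁ ∷ roles) (suc a) b G G∈ with ∈-++⁻ (map (false ∷_) (enumerate roles (suc a) b)) G∈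
  ... | inj₁ G∈ˡ = ∈-map-∷⁻ (FitsRec (pool₁ ∷ roles) (suc a) b) G∈ˡ λ F F∈ → ∈-enumerate-rec⁻ roles (suc a) b F F∈
  ... | inj₂ G∈ʳ = ∈-map-∷⁻ (FitsRec (pool₁ ∷ roles) (suc a) b) G∈ʳ λ F F∈ → a , refl , ∈-enumerate-rec⁻ roles a b F F∈
  ∈-enumerate-rec⁻ (pool₂ ∷ roles) a zero G G∈ =
    ∈-map-∷⁻ (FitsRec (pool₂ ∷ roles) a zero) G∈ λ F F∈ → ∈-enumerate-rec⁻ roles a zero F F∈
  ∈-enumerate-rec⁻ (pool₂ ∷ roles) a (suc b) G G∈ with ∈-++⁻ (map (false ∷_) (enumerate roles a (suc b))) G∈
  ... | inj₁ G∈ˡ = ∈-map-∷⁻ (FitsRec (pool₂ ∷ roles) a (suc b)) G∈ˡ λ F F∈ → ∈-enumerate-rec⁻ roles a (suc b) F F∈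
  ... | inj₂ G∈ʳ = ∈-map-∷⁻ (FitsRec (pool₂ ∷ roles) a (suc b)) G∈ʳ λ F F∈ → b , refl , ∈-enumerate-rec⁻ roles a b F F∈

  false∷≢true∷ : ∀ {xs ys : List (Subset n)} {v} → ¬ (v ∈ᶠ map (false ∷_) xs × v ∈ᶠ map (true ∷_) ys)
  false∷≢true∷ (v∈ˡ , v∈ʳ) with ∈-map⁻ _ v∈ˡ | ∈-map⁻ _ v∈ʳ
  ... | _ , _ , refl | _ , _ , ()

∈-enumerate⁺ : ∀ (roles : Vec Role n) {a b F} → Fits roles a b F → F ∈ᶠ enumerate roles a b
∈-enumerate⁺ roles {a} {b} {F} = ∈-enumerate-rec⁺ roles a b F ∘ Fits⇒FitsRec roles a b F

∈-enumerate⁻ : ∀ (roles : Vec Role n) {a b G} → G ∈ᶠ enumerate roles a b → Fits roles a b G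
∈-enumerate⁻ roles {a} {b} {G} = FitsRec⇒Fits roles a b G ∘ ∈-enumerate-rec⁻ roles a b G

enumerate-unique : ∀ (roles : Vec Role n) a b → Unique (enumerate roles a b)
enumerate-unique [] zero zero = [] ∷ []
enumerate-unique [] zero (suc b) = []
enumerate-unique [] (suc a) b = []
enumerate-unique (required ∷ roles) a b = Uniqueₚ.map⁺ ∷-injectiveʳ (enumerate-unique roles a b)
enumerate-unique (forbidden ∷ roles) a b = Uniqueₚ.map⁺ ∷-injectiveʳ (enumerate-unique roles a b)
enumerate-unique (pool₁ ∷ roles) zero b = Uniqueₚ.map⁺ ∷-injectiveʳ (enumerate-unique roles zero b)
enumerate-unique (pool₁ ∷ roles) (suc a) b =
  Uniqueₚ.++⁺ (Uniqueₚ.map⁺ ∷-injectiveʳ (enumerate-unique roles (suc a) b))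
             (Uniqueₚ.map⁺ ∷-injectiveʳ (enumerate-unique roles a b)) false∷≢true∷
enumerate-unique (pool₂ ∷ roles) a zero = Uniqueₚ.map⁺ ∷-injectiveʳ (enumerate-unique roles a zero)
enumerate-unique (pool₂ ∷ roles) a (suc b) =
  Uniqueₚ.++⁺ (Uniqueₚ.map⁺ ∷-injectiveʳ (enumerate-unique roles a (suc b)))
             (Uniqueₚ.map⁺ ∷-injectiveʳ (enumerate-unique roles a b)) false∷≢true∷

length-enumerate : ∀ (roles : Vec Role n) a b →
  length (enumerate roles a b) ≡ (∣ assigned pool₁ roles ∣ choose a) * (∣ assigned pool₂ roles ∣ choose b)
length-enumerate [] zero zero = refl
length-enumerate [] zero (suc b) = refl
length-enumerate [] (suc a) b = refl
length-enumerate (required ∷ roles) a b = trans (length-map _ (enumerate roles a b)) (length-enumerate roles a b)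
length-enumerate (forbidden ∷ roles) a b = trans (length-map _ (enumerate roles a b)) (length-enumerate roles a b)
length-enumerate (pool₁ ∷ roles) zero b = trans (length-map _ (enumerate roles zero b)) (length-enumerate roles zero b)
length-enumerate (pool₁ ∷ roles) (suc a) b = begin
  length (map (false ∷_) (enumerate roles (suc a) b) ++ map (true ∷_) (enumerate roles a b))
    ≡⟨ length-++ (map (false ∷_) (enumerate roles (suc a) b)) ⟩
  length (map (false ∷_) (enumerate roles (suc a) b)) + length (map (true ∷_) (enumerate roles a b))
    ≡⟨ cong₂ _+_ (length-map _ (enumerate roles (suc a) b)) (length-map _ (enumerate roles a b)) ⟩
  length (enumerate roles (suc a) b) + length (enumerate roles a b)
    ≡⟨ cong₂ _+_ (length-enumerate roles (suc a) b) (length-enumerate roles a b) ⟩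
  (p choose suc a) * c + (p choose a) * c ≡⟨ *-distribʳ-+ c (p choose suc a) (p choose a) ⟨
  ((p choose suc a) + (p choose a)) * c   ≡⟨ cong (_* c) (+-comm (p choose suc a) (p choose a)) ⟩
  ((p choose a) + (p choose suc a)) * c   ≡⟨ cong (_* c) (nCk+nC[k+1]≡[n+1]C[k+1] p a) ⟩
  (suc p choose suc a) * c           ∎
  where
    open ≡-Reasoning
    p = ∣ assigned pool₁ roles ∣
    c = ∣ assigned pool₂ roles ∣ choose b
length-enumerate (pool₂ ∷ roles) a zero = trans (length-map _ (enumerate roles a zero)) (length-enumerate roles a zero)
length-enumerate (pool₂ ∷ roles) a (suc b) = begin
  length (map (false ∷_) (enumerate roles a (suc b)) ++ map (true ∷_) (enumerate roles a b))
    ≡⟨ length-++ (map (false ∷_) (enumerate roles a (suc b))) ⟩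
  length (map (false ∷_) (enumerate roles a (suc b))) + length (map (true ∷_) (enumerate roles a b))
    ≡⟨ cong₂ _+_ (length-map _ (enumerate roles a (suc b))) (length-map _ (enumerate roles a b)) ⟩
  length (enumerate roles a (suc b)) + length (enumerate roles a b)
    ≡⟨ cong₂ _+_ (length-enumerate roles a (suc b)) (length-enumerate roles a b) ⟩
  c * (q choose suc b) + c * (q choose b) ≡⟨ *-distribˡ-+ c (q choose suc b) (q choose b) ⟨
  c * ((q choose suc b) + (q choose b))   ≡⟨ cong (c *_) (+-comm (q choose suc b) (q choose b)) ⟩
  c * ((q choose b) + (q choose suc b))   ≡⟨ cong (c *_) (nCk+nC[k+1]≡[n+1]C[k+1] q b) ⟩
  c * (suc q choose suc b)           ∎
  where
    open ≡-Reasoning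
    q = ∣ assigned pool₂ roles ∣
    c = ∣ assigned pool₁ roles ∣ choose a

rolesE₁ : Subset n → Vec Role n
rolesE₁ = Data.Vec.map λ { true → required ; false → pool₁ }

rolesE₂ rolesE₃ : Subset n → Subset n → Vec Role n
rolesE₂ = Data.Vec.zipWith λ { true _ → required ; false true → forbidden ; false false → pool₁ }
rolesE₃ = Data.Vec.zipWith λ { true _ → pool₁ ; false true → required ; false false → pool₂ }

required-E₁ : (X : Subset n) → assigned required (rolesE₁ X) ≡ X
required-E₁ [] = refl
required-E₁ (true ∷ X) = cong (true ∷_) (required-E₁ X)
required-E₁ (false ∷ X) = cong (false ∷_) (required-E₁ X)

forbidden-E₁ : (X : Subset n) → assigned forbidden (rolesE₁ X) ≡ ⊥
forbidden-E₁ [] = refl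
forbidden-E₁ (true ∷ X) = cong (false ∷_) (forbidden-E₁ X)
forbidden-E₁ (false ∷ X) = cong (false ∷_) (forbidden-E₁ X)

pool₁-E₁ : (X : Subset n) → assigned pool₁ (rolesE₁ X) ≡ ∁ X
pool₁-E₁ [] = refl
pool₁-E₁ (true ∷ X) = cong (false ∷_) (pool₁-E₁ X)
pool₁-E₁ (false ∷ X) = cong (true ∷_) (pool₁-E₁ X)

pool₂-E₁ : (X : Subset n) → assigned pool₂ (rolesE₁ X) ≡ ⊥
pool₂-E₁ [] = refl
pool₂-E₁ (true ∷ X) = cong (false ∷_) (pool₂-E₁ X)
pool₂-E₁ (false ∷ X) = cong (false ∷_) (pool₂-E₁ X)

required-E₂ : (X M : Subset n) → assigned required (rolesE₂ X M) ≡ X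
required-E₂ [] [] = refl
required-E₂ (true ∷ X) (_ ∷ M) = cong (true ∷_) (required-E₂ X M)
required-E₂ (false ∷ X) (true ∷ M) = cong (false ∷_) (required-E₂ X M)
required-E₂ (false ∷ X) (false ∷ M) = cong (false ∷_) (required-E₂ X M)

forbidden-E₂ : (X M : Subset n) {i : Fin n} → i ∈ M → i ∉ X → i ∈ assigned forbidden (rolesE₂ X M)
forbidden-E₂ (true ∷ X) (_ ∷ M) here i∉X = ⊥-elim (i∉X here)
forbidden-E₂ (false ∷ X) (true ∷ M) here _ = here
forbidden-E₂ (true ∷ X) (_ ∷ M) (there i∈M) i∉X = there (forbidden-E₂ X M i∈M (i∉X ∘ there))
forbidden-E₂ (false ∷ X) (true ∷ M) (there i∈M) i∉X = there (forbidden-E₂ X M i∈M (i∉X ∘ there))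
forbidden-E₂ (false ∷ X) (false ∷ M) (there i∈M) i∉X = there (forbidden-E₂ X M i∈M (i∉X ∘ there))

pool₁-E₂ : (X M : Subset n) → X ⊆ M → assigned pool₁ (rolesE₂ X M) ≡ ∁ M
pool₁-E₂ [] [] _ = refl
pool₁-E₂ (true ∷ X) (true ∷ M) X⊆M = cong (false ∷_) (pool₁-E₂ X M (drop-∷-⊆ X⊆M))
pool₁-E₂ (true ∷ X) (false ∷ M) X⊆M with X⊆M here
... | ()
pool₁-E₂ (false ∷ X) (true ∷ M) X⊆M = cong (false ∷_) (pool₁-E₂ X M (drop-∷-⊆ X⊆M))
pool₁-E₂ (false ∷ X) (false ∷ M) X⊆M = cong (true ∷_) (pool₁-E₂ X M (drop-∷-⊆ X⊆M))

pool₂-E₂ : (X M : Subset n) → assigned pool₂ (rolesE₂ X M) ≡ ⊥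
pool₂-E₂ [] [] = refl
pool₂-E₂ (true ∷ X) (_ ∷ M) = cong (false ∷_) (pool₂-E₂ X M)
pool₂-E₂ (false ∷ X) (true ∷ M) = cong (false ∷_) (pool₂-E₂ X M)
pool₂-E₂ (false ∷ X) (false ∷ M) = cong (false ∷_) (pool₂-E₂ X M)

required-E₃ : (X M : Subset n) {i : Fin n} → i ∈ assigned required (rolesE₃ X M) → i ∈ M × i ∉ X
required-E₃ (false ∷ X) (true ∷ M) here = here , λ ()
required-E₃ (true ∷ X) (_ ∷ M) (there i∈) =
  let i∈M , i∉X = required-E₃ X M i∈ in there i∈M , i∉X ∘ drop-there
required-E₃ (false ∷ X) (true ∷ M) (there i∈) =
  let i∈M , i∉X = required-E₃ X M i∈ in there i∈M , i∉X ∘ drop-there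
required-E₃ (false ∷ X) (false ∷ M) (there i∈) =
  let i∈M , i∉X = required-E₃ X M i∈ in there i∈M , i∉X ∘ drop-there

forbidden-E₃ : (X M : Subset n) → assigned forbidden (rolesE₃ X M) ≡ ⊥
forbidden-E₃ [] [] = refl
forbidden-E₃ (true ∷ X) (_ ∷ M) = cong (false ∷_) (forbidden-E₃ X M)
forbidden-E₃ (false ∷ X) (true ∷ M) = cong (false ∷_) (forbidden-E₃ X M)
forbidden-E₃ (false ∷ X) (false ∷ M) = cong (false ∷_) (forbidden-E₃ X M)

pool₁-E₃ : (X M : Subset n) → assigned pool₁ (rolesE₃ X M) ≡ X
pool₁-E₃ [] [] = refl
pool₁-E₃ (true ∷ X) (_ ∷ M) = cong (true ∷_) (pool₁-E₃ X M)
pool₁-E₃ (false ∷ X) (true ∷ M) = cong (false ∷_) (pool₁-E₃ X M)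
pool₁-E₃ (false ∷ X) (false ∷ M) = cong (false ∷_) (pool₁-E₃ X M)

pool₂-E₃ : (X M : Subset n) → X ⊆ M → assigned pool₂ (rolesE₃ X M) ≡ ∁ M
pool₂-E₃ [] [] _ = refl
pool₂-E₃ (true ∷ X) (true ∷ M) X⊆M = cong (false ∷_) (pool₂-E₃ X M (drop-∷-⊆ X⊆M))
pool₂-E₃ (true ∷ X) (false ∷ M) X⊆M with X⊆M here
... | ()
pool₂-E₃ (false ∷ X) (true ∷ M) X⊆M = cong (false ∷_) (pool₂-E₃ X M (drop-∷-⊆ X⊆M))
pool₂-E₃ (false ∷ X) (false ∷ M) X⊆M = cong (true ∷_) (pool₂-E₃ X M (drop-∷-⊆ X⊆M))

-- Counting families without an E₂-member

record E₃Shape (X M F : Subset n) (x y : Fin n) : Set where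
  field
    missing∈X : x ∈ X
    M∖F≐⁅missing⁆ : M ∖ F ≐⁅ x ⁆
    F∖M≐⁅extra⁆ : F ∖ M ≐⁅ y ⁆

E₃-shape : {X M F : Subset n} → X ⊆ M → suc ∣ F ∩ X ∣ ≡ ∣ X ∣ → suc ∣ F ∩ M ∣ ≡ ∣ M ∣ → ∣ F ∣ ≡ ∣ M ∣ →
           ∃₂ (E₃Shape X M F)
E₃-shape {n} {X} {M} {F} X⊆M 1+∣F∩X∣≡∣X∣ 1+∣F∩M∣≡∣M∣ ∣F∣≡∣M∣ = x , y , record
  { missing∈X = subst (_∈ X) (∖≐⁅⁆⇒≡ M∖F≐x (X⊆M x′∈X) x′∉F) x′∈X
  ; M∖F≐⁅missing⁆ = M∖F≐x
  ; F∖M≐⁅extra⁆ = q∖[q∩p]⇒q∖p (proj₂ F∖[F∩M]≐y)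
  }
  where
    X∖[F∩X]≐x′ : ∃ (X ∖ (F ∩ X) ≐⁅_⁆)
    X∖[F∩X]≐x′ = ∃-∖≐⁅⁆ (F ∩ X) X (p∩q⊆q F X) 1+∣F∩X∣≡∣X∣
    x′ : Fin n
    x′ = proj₁ X∖[F∩X]≐x′
    x′∈X : x′ ∈ X
    x′∈X = proj₁ (proj₂ X∖[F∩X]≐x′)
    x′∉F : x′ ∉ F
    x′∉F x′∈F = proj₁ (proj₂ (proj₂ X∖[F∩X]≐x′)) (x∈p∩q⁺ (x′∈F , x′∈X))
    M∖[F∩M]≐x : ∃ (M ∖ (F ∩ M) ≐⁅_⁆)
    M∖[F∩M]≐x = ∃-∖≐⁅⁆ (F ∩ M) M (p∩q⊆q F M) 1+∣F∩M∣≡∣M∣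
    x : Fin n
    x = proj₁ M∖[F∩M]≐x
    M∖F≐x : M ∖ F ≐⁅ x ⁆
    M∖F≐x = q∖[p∩q]⇒q∖p (proj₂ M∖[F∩M]≐x)
    F∖[F∩M]≐y : ∃ (F ∖ (F ∩ M) ≐⁅_⁆)
    F∖[F∩M]≐y = ∃-∖≐⁅⁆ (F ∩ M) F (p∩q⊆p F M) (trans 1+∣F∩M∣≡∣M∣ (sym ∣F∣≡∣M∣))
    y : Fin n
    y = proj₁ F∖[F∩M]≐y

1+[m∸1]≡m : ∀ {m} → 1 ≤ m → suc (m ∸ 1) ≡ m
1+[m∸1]≡m (s≤s _) = refl

m+n≤o+p⇒m≤[o∸n]+p : ∀ m n o p → m + n ≤ o + p → m ≤ (o ∸ n) + p
m+n≤o+p⇒m≤[o∸n]+p m n o p m+n≤o+p = +-cancelˡ-≤ n m ((o ∸ n) + p) (begin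
  n + m             ≡⟨ +-comm n m ⟩
  m + n             ≤⟨ m+n≤o+p ⟩
  o + p             ≤⟨ +-monoˡ-≤ p (m≤n+m∸n o n) ⟩
  n + (o ∸ n) + p   ≡⟨ +-assoc n (o ∸ n) p ⟩
  n + ((o ∸ n) + p) ∎)
  where open ≤-Reasoning

module _ {n k : ℕ} {X M : Subset n} (X⊆M : X ⊆ M) (1≤∣X∣ : 1 ≤ ∣ X ∣) (∣M∣≡k : ∣ M ∣ ≡ k) where

  private
    1+[k∸1]≡∣M∣ : suc (k ∸ 1) ≡ ∣ M ∣
    1+[k∸1]≡∣M∣ = trans (1+[m∸1]≡m (≤-trans 1≤∣X∣ (subst (∣ X ∣ ≤_) ∣M∣≡k (p⊆q⇒∣p∣≤∣q∣ X⊆M)))) (sym ∣M∣≡k)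

  InE₃⇒E₃Shape : ∀ {C F} → InE₃ k ∣ X ∣ X M C F → ∃₂ (E₃Shape X M F)
  InE₃⇒E₃Shape (∣F∣≡k , _ , ∣F∩X∣≡∣X∣∸1 , ∣F∩M∣≡k∸1) =
    E₃-shape X⊆M (trans (cong suc ∣F∩X∣≡∣X∣∸1) (1+[m∸1]≡m 1≤∣X∣))
                 (trans (cong suc ∣F∩M∣≡k∸1) 1+[k∸1]≡∣M∣) (trans ∣F∣≡k (sym ∣M∣≡k))

  InE₃⇒∣F∩∁M∣≡1 : ∀ {C F} → InE₃ k ∣ X ∣ X M C F → ∣ F ∩ ∁ M ∣ ≡ 1
  InE₃⇒∣F∩∁M∣≡1 {F = F} (∣F∣≡k , _ , _ , ∣F∩M∣≡k∸1) = +-cancelˡ-≡ ∣ F ∩ M ∣ _ _ (begin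
    ∣ F ∩ M ∣ + ∣ F ∩ ∁ M ∣ ≡⟨ ∣p∣≡∣p∩q∣+∣p∩∁q∣ F M ⟨
    ∣ F ∣                  ≡⟨ trans ∣F∣≡k (sym ∣M∣≡k) ⟩
    ∣ M ∣                  ≡⟨ trans (cong suc ∣F∩M∣≡k∸1) 1+[k∸1]≡∣M∣ ⟨
    suc ∣ F ∩ M ∣          ≡⟨ +-comm 1 _ ⟩
    ∣ F ∩ M ∣ + 1          ∎)
    where open ≡-Reasoning

  -- ℰ₁: k-sets containing X;  ℰ₂: k-sets meeting M exactly in X;  ℰ₃: k-sets with |F ∩ X| = |X| - 1,
  -- M ∖ X ⊆ F and one point outside M.
  ℰ₁ ℰ₂ ℰ₃ : Family n
  ℰ₁ = enumerate (rolesE₁ X) (k ∸ ∣ X ∣) 0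
  ℰ₂ = enumerate (rolesE₂ X M) (k ∸ ∣ X ∣) 0
  ℰ₃ = enumerate (rolesE₃ X M) (∣ X ∣ ∸ 1) 1

  private
    ∣p∩⊥∣≡0 : (p : Subset n) → ∣ p ∩ ⊥ ∣ ≡ 0
    ∣p∩⊥∣≡0 p = trans (cong ∣_∣ (∩-zeroʳ p)) (∣⊥∣≡0 n)

    ∣F∩∁X∣≡k∸∣X∣ : ∀ {F} → X ⊆ F → ∣ F ∣ ≡ k → ∣ F ∩ ∁ X ∣ ≡ k ∸ ∣ X ∣
    ∣F∩∁X∣≡k∸∣X∣ {F} X⊆F ∣F∣≡k = begin
      ∣ F ∩ ∁ X ∣                     ≡⟨ m+n∸m≡n ∣ X ∣ _ ⟨
      ∣ X ∣ + ∣ F ∩ ∁ X ∣ ∸ ∣ X ∣       ≡⟨ cong (λ m → m + ∣ F ∩ ∁ X ∣ ∸ ∣ X ∣) (cong ∣_∣ (q⊆p⇒p∩q≡q X⊆F)) ⟨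
      ∣ F ∩ X ∣ + ∣ F ∩ ∁ X ∣ ∸ ∣ X ∣   ≡⟨ cong (_∸ ∣ X ∣) (∣p∣≡∣p∩q∣+∣p∩∁q∣ F X) ⟨
      ∣ F ∣ ∸ ∣ X ∣                   ≡⟨ cong (_∸ ∣ X ∣) ∣F∣≡k ⟩
      k ∸ ∣ X ∣                       ∎
      where open ≡-Reasoning

  X⊆F⇒∈ℰ₁ : ∀ {F} → X ⊆ F → ∣ F ∣ ≡ k → F ∈ᶠ ℰ₁
  X⊆F⇒∈ℰ₁ {F} X⊆F ∣F∣≡k = ∈-enumerate⁺ (rolesE₁ X)
    ( (λ i∈ → X⊆F (subst (_ ∈_) (required-E₁ X) i∈))
    , (λ i∈ → ⊥-elim (∉⊥ (subst (_ ∈_) (forbidden-E₁ X) i∈)))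
    , trans (cong (∣_∣ ∘ (F ∩_)) (pool₁-E₁ X)) (∣F∩∁X∣≡k∸∣X∣ X⊆F ∣F∣≡k)
    , trans (cong (∣_∣ ∘ (F ∩_)) (pool₂-E₁ X)) (∣p∩⊥∣≡0 F) )

  InE₃⇒∈ℰ₃ : ∀ {C F} → InE₃ k ∣ X ∣ X M C F → F ∈ᶠ ℰ₃
  InE₃⇒∈ℰ₃ {F = F} F∈E₃@(_ , _ , ∣F∩X∣≡∣X∣∸1 , _) = ∈-enumerate⁺ (rolesE₃ X M)
    ( M∖X⊆F
    , (λ i∈ → ⊥-elim (∉⊥ (subst (_ ∈_) (forbidden-E₃ X M) i∈)))
    , trans (cong (∣_∣ ∘ (F ∩_)) (pool₁-E₃ X M)) ∣F∩X∣≡∣X∣∸1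
    , trans (cong (∣_∣ ∘ (F ∩_)) (pool₂-E₃ X M X⊆M)) (InE₃⇒∣F∩∁M∣≡1 F∈E₃) )
    where
      open E₃Shape (proj₂ (proj₂ (InE₃⇒E₃Shape F∈E₃)))
      M∖X⊆F : assigned required (rolesE₃ X M) ⊆ F
      M∖X⊆F i∈ = let i∈M , i∉X = required-E₃ X M i∈
                 in proj₂ (proj₂ M∖F≐⁅missing⁆) i∈M (λ { refl → i∉X missing∈X })

  module _ {G : Subset n} (G∈ℰ₂ : G ∈ᶠ ℰ₂) where

    private
      G-fits : Fits (rolesE₂ X M) (k ∸ ∣ X ∣) 0 G
      G-fits = ∈-enumerate⁻ (rolesE₂ X M) G∈ℰ₂

    ℰ₂⇒X⊆G : X ⊆ G
    ℰ₂⇒X⊆G i∈X = proj₁ G-fits (subst (_ ∈_) (sym (required-E₂ X M)) i∈X)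

    ℰ₂⇒M∖X∩G≡∅ : ∀ {i} → i ∈ M → i ∉ X → i ∉ G
    ℰ₂⇒M∖X∩G≡∅ i∈M i∉X = proj₁ (proj₂ G-fits) (forbidden-E₂ X M i∈M i∉X)

    ℰ₂⇒∣G∩M∣≤∣X∣ : ∣ G ∩ M ∣ ≤ ∣ X ∣
    ℰ₂⇒∣G∩M∣≤∣X∣ = p⊆q⇒∣p∣≤∣q∣ G∩M⊆X
      where
        G∩M⊆X : G ∩ M ⊆ X
        G∩M⊆X {i} i∈G∩M with x∈p∩q⁻ G M i∈G∩M | i ∈? X
        ... | _ | yes i∈X = i∈X
        ... | i∈G , i∈M | no i∉X = ⊥-elim (ℰ₂⇒M∖X∩G≡∅ i∈M i∉X i∈G)

    ℰ₂⊆ℰ₁ : G ∈ᶠ ℰ₁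
    ℰ₂⊆ℰ₁ = ∈-enumerate⁺ (rolesE₁ X)
      ( (λ i∈ → ℰ₂⇒X⊆G (subst (_ ∈_) (required-E₁ X) i∈))
      , (λ i∈ → ⊥-elim (∉⊥ (subst (_ ∈_) (forbidden-E₁ X) i∈)))
      , trans (cong (∣_∣ ∘ (G ∩_)) (pool₁-E₁ X)) ∣G∩∁X∣≡k∸∣X∣
      , trans (cong (∣_∣ ∘ (G ∩_)) (pool₂-E₁ X)) (∣p∩⊥∣≡0 G) )
      where
        G∩∁X≡G∩∁M : G ∩ ∁ X ≡ G ∩ ∁ M
        G∩∁X≡G∩∁M = ⊆-antisym
          (λ i∈ → let i∈G , i∈∁X = x∈p∩q⁻ G (∁ X) i∈ in
            x∈p∩q⁺ (i∈G , x∉p⇒x∈∁p (λ i∈M → ℰ₂⇒M∖X∩G≡∅ i∈M (x∈∁p⇒x∉p i∈∁X) i∈G)))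
          (λ i∈ → let i∈G , i∈∁M = x∈p∩q⁻ G (∁ M) i∈ in
            x∈p∩q⁺ (i∈G , x∉p⇒x∈∁p (x∈∁p⇒x∉p i∈∁M ∘ X⊆M)))
        ∣G∩∁X∣≡k∸∣X∣ : ∣ G ∩ ∁ X ∣ ≡ k ∸ ∣ X ∣
        ∣G∩∁X∣≡k∸∣X∣ = trans (cong ∣_∣ G∩∁X≡G∩∁M)
          (trans (cong (∣_∣ ∘ (G ∩_)) (sym (pool₁-E₂ X M X⊆M))) (proj₁ (proj₂ (proj₂ G-fits))))

  length-ℰ₁ : length ℰ₁ ≡ (n ∸ ∣ X ∣) choose (k ∸ ∣ X ∣)
  length-ℰ₁ = trans (length-enumerate (rolesE₁ X) (k ∸ ∣ X ∣) 0)
    (trans (*-identityʳ _) (cong (_choose (k ∸ ∣ X ∣)) (trans (cong ∣_∣ (pool₁-E₁ X)) (∣∁p∣≡n∸∣p∣ X))))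

  length-ℰ₂ : length ℰ₂ ≡ (n ∸ k) choose (k ∸ ∣ X ∣)
  length-ℰ₂ = trans (length-enumerate (rolesE₂ X M) (k ∸ ∣ X ∣) 0)
    (trans (*-identityʳ _) (cong (_choose (k ∸ ∣ X ∣))
      (trans (cong ∣_∣ (pool₁-E₂ X M X⊆M)) (trans (∣∁p∣≡n∸∣p∣ M) (cong (n ∸_) ∣M∣≡k)))))

  length-ℰ₃ : length ℰ₃ ≡ ∣ X ∣ * (n ∸ k)
  length-ℰ₃ = trans (length-enumerate (rolesE₃ X M) (∣ X ∣ ∸ 1) 1) (cong₂ _*_
    (trans (cong (λ p → ∣ p ∣ choose (∣ X ∣ ∸ 1)) (pool₁-E₃ X M)) ∣X∣choose[∣X∣∸1]≡∣X∣)
    (trans (cong (λ q → ∣ q ∣ choose 1) (pool₂-E₃ X M X⊆M))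
      (trans (nC1≡n _) (trans (∣∁p∣≡n∸∣p∣ M) (cong (n ∸_) ∣M∣≡k)))))
    where
      ∣X∣choose[∣X∣∸1]≡∣X∣ : ∣ X ∣ choose (∣ X ∣ ∸ 1) ≡ ∣ X ∣
      ∣X∣choose[∣X∣∸1]≡∣X∣ = trans (nCk≡nC[n∸k] (m∸n≤m ∣ X ∣ 1))
        (trans (cong (∣ X ∣ choose_) (m∸[m∸n]≡n 1≤∣X∣)) (nC1≡n ∣ X ∣))

  length≤h₁ : {C : Subset n} (𝓕 : Family n) → Unique 𝓕 →
              (∀ F → F ∈ᶠ 𝓕 → InE₁ k (∣ X ∣) X M F ⊎ InE₃ k (∣ X ∣) X M C F) →
              length 𝓕 ≤ h₁ ∣ X ∣ k n
  length≤h₁ 𝓕 𝓕-unique E₁⊎E₃ = subst (length 𝓕 ≤_) h₁-formula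
    (m+n≤o+p⇒m≤[o∸n]+p (length 𝓕) (length ℰ₂) (length ℰ₁) (length ℰ₃) 𝓕+ℰ₂≤ℰ₁+ℰ₃)
    where
      𝓕∩ℰ₂≡∅ : ∀ {F} → ¬ (F ∈ᶠ 𝓕 × F ∈ᶠ ℰ₂)
      𝓕∩ℰ₂≡∅ {F} (F∈𝓕 , F∈ℰ₂) with E₁⊎E₃ F F∈𝓕
      ... | inj₁ (_ , _ , ∣X∣<∣F∩M∣) = <⇒≱ ∣X∣<∣F∩M∣ (ℰ₂⇒∣G∩M∣≤∣X∣ F∈ℰ₂)
      ... | inj₂ F∈E₃ = let open E₃Shape (proj₂ (proj₂ (InE₃⇒E₃Shape F∈E₃)))
                        in proj₁ (proj₂ M∖F≐⁅missing⁆) (ℰ₂⇒X⊆G F∈ℰ₂ missing∈X)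
      𝓕++ℰ₂⊆ℰ₁++ℰ₃ : ∀ {F} → F ∈ᶠ 𝓕 ++ ℰ₂ → F ∈ᶠ ℰ₁ ++ ℰ₃
      𝓕++ℰ₂⊆ℰ₁++ℰ₃ {F} F∈ with ∈-++⁻ 𝓕 F∈
      ... | inj₂ F∈ℰ₂ = ∈-++⁺ˡ (ℰ₂⊆ℰ₁ F∈ℰ₂)
      ... | inj₁ F∈𝓕 with E₁⊎E₃ F F∈𝓕
      ... | inj₁ (∣F∣≡k , X⊆F , _) = ∈-++⁺ˡ (X⊆F⇒∈ℰ₁ X⊆F ∣F∣≡k)
      ... | inj₂ F∈E₃ = ∈-++⁺ʳ ℰ₁ (InE₃⇒∈ℰ₃ F∈E₃)
      𝓕+ℰ₂≤ℰ₁+ℰ₃ : length 𝓕 + length ℰ₂ ≤ length ℰ₁ + length ℰ₃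
      𝓕+ℰ₂≤ℰ₁+ℰ₃ = subst₂ _≤_ (length-++ 𝓕) (length-++ ℰ₁)
        (Unique∧⊆⇒length≤ (𝓕 ++ ℰ₂) (ℰ₁ ++ ℰ₃)
          (Uniqueₚ.++⁺ 𝓕-unique (enumerate-unique (rolesE₂ X M) (k ∸ ∣ X ∣) 0) 𝓕∩ℰ₂≡∅) 𝓕++ℰ₂⊆ℰ₁++ℰ₃)
      h₁-formula : (length ℰ₁ ∸ length ℰ₂) + length ℰ₃ ≡ h₁ ∣ X ∣ k n
      h₁-formula = cong₂ _+_ (cong₂ _∸_ length-ℰ₁ length-ℰ₂) length-ℰ₃

-- Families with an E₂-member

x∈⋂⁻ : (ps : List (Subset n)) {x : Fin n} → x ∈ ⋂ ps → All (x ∈_) ps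
x∈⋂⁻ [] _ = []
x∈⋂⁻ (p ∷ ps) x∈ = let x∈p , x∈⋂ps = x∈p∩q⁻ p (⋂ ps) x∈ in x∈p ∷ x∈⋂⁻ ps x∈⋂ps

RWiseTIntersecting⇒t≤∣⋂∣ : ∀ {t} {𝓕 : Family n} (Gs : List (Subset n)) →
  RWiseTIntersecting (length Gs) t 𝓕 → All (_∈ᶠ 𝓕) Gs → t ≤ ∣ ⋂ Gs ∣
RWiseTIntersecting⇒t≤∣⋂∣ {t = t} Gs rw Gs⊆𝓕 =
  subst (λ Hs → t ≤ ∣ ⋂ Hs ∣) (tabulate-lookup Gs) (rw (lookup Gs) (All.lookup Gs⊆𝓕 ∘ ∈-lookup))

E₂⇒X⊆F : {X M F : Subset n} → F ∩ M ≡ X → X ⊆ F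
E₂⇒X⊆F {M = M} {F} F∩M≡X x∈X = proj₁ (x∈p∩q⁻ F M (subst (_ ∈_) (sym F∩M≡X) x∈X))

InE₂⇒C∖M⊆F : ∀ {k} {X M C F : Subset n} → M ⊆ C → ∣ M ∣ ≡ k →
             InE₂ k ∣ X ∣ ∣ C ∣ X M C F → C ∩ ∁ M ⊆ F
InE₂⇒C∖M⊆F {k = k} {X} {M} {C} {F} M⊆C ∣M∣≡k (_ , F∩M≡X , ∣F∩C∣≡∣C∣∸k+∣X∣) z∈C∖M =
  proj₁ (x∈p∩q⁻ F C (proj₁ (x∈p∩q⁻ (F ∩ C) (∁ M) (C∖M⊆F∩C∖M z∈C∖M))))
  where
    F∩C∖M⊆C∖M : (F ∩ C) ∩ ∁ M ⊆ C ∩ ∁ M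
    F∩C∖M⊆C∖M z∈ = let z∈F∩C , z∉M = x∈p∩q⁻ (F ∩ C) (∁ M) z∈ in x∈p∩q⁺ (proj₂ (x∈p∩q⁻ F C z∈F∩C) , z∉M)
    [F∩C]∩M≡X : (F ∩ C) ∩ M ≡ X
    [F∩C]∩M≡X = trans (⊆-antisym
      (λ z∈ → let z∈F∩C , z∈M = x∈p∩q⁻ (F ∩ C) M z∈ in x∈p∩q⁺ (proj₁ (x∈p∩q⁻ F C z∈F∩C) , z∈M))
      (λ z∈ → let z∈F , z∈M = x∈p∩q⁻ F M z∈ in x∈p∩q⁺ (x∈p∩q⁺ (z∈F , M⊆C z∈M) , z∈M))) F∩M≡X
    ∣F∩C∖M∣ : ∣ (F ∩ C) ∩ ∁ M ∣ ≡ ∣ C ∣ ∸ k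
    ∣F∩C∖M∣ = +-cancelˡ-≡ ∣ X ∣ _ _ (begin
      ∣ X ∣ + ∣ (F ∩ C) ∩ ∁ M ∣             ≡⟨ cong (λ Y → ∣ Y ∣ + _) [F∩C]∩M≡X ⟨
      ∣ (F ∩ C) ∩ M ∣ + ∣ (F ∩ C) ∩ ∁ M ∣     ≡⟨ ∣p∣≡∣p∩q∣+∣p∩∁q∣ (F ∩ C) M ⟨
      ∣ F ∩ C ∣                             ≡⟨ ∣F∩C∣≡∣C∣∸k+∣X∣ ⟩
      (∣ C ∣ ∸ k) + ∣ X ∣                    ≡⟨ +-comm (∣ C ∣ ∸ k) ∣ X ∣ ⟩
      ∣ X ∣ + (∣ C ∣ ∸ k)                    ∎)
      where open ≡-Reasoning
    ∣C∖M∣ : ∣ C ∩ ∁ M ∣ ≡ ∣ C ∣ ∸ k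
    ∣C∖M∣ = begin
      ∣ C ∩ ∁ M ∣                     ≡⟨ m+n∸m≡n k _ ⟨
      k + ∣ C ∩ ∁ M ∣ ∸ k             ≡⟨ cong (λ m → m + _ ∸ k) (trans (cong ∣_∣ (q⊆p⇒p∩q≡q M⊆C)) ∣M∣≡k) ⟨
      ∣ C ∩ M ∣ + ∣ C ∩ ∁ M ∣ ∸ k     ≡⟨ cong (_∸ k) (∣p∣≡∣p∩q∣+∣p∩∁q∣ C M) ⟨
      ∣ C ∣ ∸ k                       ∎
      where open ≡-Reasoning
    C∖M⊆F∩C∖M : C ∩ ∁ M ⊆ (F ∩ C) ∩ ∁ M
    C∖M⊆F∩C∖M = p⊆q∧∣q∣≤∣p∣⇒q⊆p _ _ F∩C∖M⊆C∖M (≤-reflexive (trans ∣C∖M∣ (sym ∣F∩C∖M∣)))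

InH₁⇒InH[M∪⁅y⁆] : ∀ {k} {X M C F : Subset n} {y : Fin n} → M ⊆ C → ∣ M ∣ ≡ k → X ⊆ M → y ∈ C → y ∉ M →
  InH₁ k X M C F → (InE₃ k ∣ X ∣ X M C F → F ⊆ M ∪ ⁅ y ⁆) → InH k (suc ∣ X ∣) X (M ∪ ⁅ y ⁆) F
InH₁⇒InH[M∪⁅y⁆] {M = M} {F = F} {y} _ _ _ _ _ (inj₁ (∣F∣≡k , X⊆F , ∣X∣<∣F∩M∣)) _ =
  ∣F∣≡k , inj₁ (X⊆F , ≤-trans ∣X∣<∣F∩M∣ (p⊆q⇒∣p∣≤∣q∣ F∩M⊆F∩M∪⁅y⁆))
  where
    F∩M⊆F∩M∪⁅y⁆ : F ∩ M ⊆ F ∩ (M ∪ ⁅ y ⁆)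
    F∩M⊆F∩M∪⁅y⁆ z∈ = let z∈F , z∈M = x∈p∩q⁻ F M z∈ in x∈p∩q⁺ (z∈F , p⊆p∪q ⁅ y ⁆ z∈M)
InH₁⇒InH[M∪⁅y⁆] {X = X} {M} {F = F} {y} M⊆C ∣M∣≡k X⊆M y∈C y∉M (inj₂ (inj₁ F∈E₂@(∣F∣≡k , F∩M≡X , _))) _ =
  ∣F∣≡k , inj₁ (X⊆F , subst (_≤ ∣ F ∩ (M ∪ ⁅ y ⁆) ∣) (x∉p⇒∣p∪⁅x⁆∣≡1+∣p∣ X y (y∉M ∘ X⊆M)) (p⊆q⇒∣p∣≤∣q∣ X∪⁅y⁆⊆F∩M∪⁅y⁆))
  where
    X⊆F : X ⊆ F
    X⊆F = E₂⇒X⊆F F∩M≡X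
    y∈F : y ∈ F
    y∈F = InE₂⇒C∖M⊆F M⊆C ∣M∣≡k F∈E₂ (x∈p∩q⁺ (y∈C , x∉p⇒x∈∁p y∉M))
    X∪⁅y⁆⊆F∩M∪⁅y⁆ : X ∪ ⁅ y ⁆ ⊆ F ∩ (M ∪ ⁅ y ⁆)
    X∪⁅y⁆⊆F∩M∪⁅y⁆ z∈ with x∈p∪q⁻ X ⁅ y ⁆ z∈
    ... | inj₁ z∈X = x∈p∩q⁺ (X⊆F z∈X , p⊆p∪q ⁅ y ⁆ (X⊆M z∈X))
    ... | inj₂ z∈⁅y⁆ = subst (_∈ F ∩ (M ∪ ⁅ y ⁆)) (sym (x∈⁅y⁆⇒x≡y y z∈⁅y⁆)) (x∈p∩q⁺ (y∈F , q⊆p∪q M ⁅ y ⁆ (x∈⁅x⁆ y)))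
InH₁⇒InH[M∪⁅y⁆] _ _ _ _ _ (inj₂ (inj₂ F∈E₃)) F∈E₃⇒F⊆M∪⁅y⁆ = proj₁ F∈E₃ , inj₂ (F∈E₃⇒F⊆M∪⁅y⁆ F∈E₃)

module _ {n k : ℕ} {X M C : Subset n} {𝓕 : Family n}
         (X⊆M : X ⊆ M) (1≤∣X∣ : 1 ≤ ∣ X ∣) (∣M∣≡k : ∣ M ∣ ≡ k)
         (𝓕⊆H₁ : ∀ F → F ∈ᶠ 𝓕 → InH₁ k X M C F) where

  record E₃Member : Set where
    field
      set : Subset n
      set∈𝓕 : set ∈ᶠ 𝓕
      set∈E₃ : InE₃ k ∣ X ∣ X M C set

    missing extra : Fin n
    missing = proj₁ (InE₃⇒E₃Shape X⊆M 1≤∣X∣ ∣M∣≡k set∈E₃)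
    extra = proj₁ (proj₂ (InE₃⇒E₃Shape X⊆M 1≤∣X∣ ∣M∣≡k set∈E₃))

    shape : E₃Shape X M set missing extra
    shape = proj₂ (proj₂ (InE₃⇒E₃Shape X⊆M 1≤∣X∣ ∣M∣≡k set∈E₃))

  open E₃Member

  ListsE₃Members : List E₃Member → Set
  ListsE₃Members P = ∀ F → F ∈ᶠ 𝓕 → InE₃ k ∣ X ∣ X M C F → Any (λ p → set p ≡ F) P

  X⊆F⇒∉E₃ : ∀ {F} → X ⊆ F → ¬ InE₃ k ∣ X ∣ X M C F
  X⊆F⇒∉E₃ X⊆F F∈E₃ =
    let open E₃Shape (proj₂ (proj₂ (InE₃⇒E₃Shape X⊆M 1≤∣X∣ ∣M∣≡k F∈E₃)))
    in proj₁ (proj₂ M∖F≐⁅missing⁆) (X⊆F missing∈X)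

  ∃-ListsE₃Members : ∃ ListsE₃Members
  ∃-ListsE₃Members = collect 𝓕 (λ F∈𝓕 → F∈𝓕)
    where
      collect : (L : Family n) → (∀ {F} → F ∈ᶠ L → F ∈ᶠ 𝓕) →
                ∃ λ P → ∀ F → F ∈ᶠ L → InE₃ k ∣ X ∣ X M C F → Any (λ p → set p ≡ F) P
      collect [] _ = [] , λ _ ()
      collect (F ∷ L) L⊆𝓕 with collect L (L⊆𝓕 ∘ there) | 𝓕⊆H₁ F (L⊆𝓕 (here refl))
      ... | P , covers | inj₂ (inj₂ F∈E₃) =
        record { set = F ; set∈𝓕 = L⊆𝓕 (here refl) ; set∈E₃ = F∈E₃ } ∷ P ,
        λ { G (here refl) _ → here refl ; G (there G∈L) G∈E₃ → there (covers G G∈L G∈E₃) }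
      ... | P , covers | inj₁ (_ , X⊆F , _) =
        P , λ { G (here refl) G∈E₃ → ⊥-elim (X⊆F⇒∉E₃ X⊆F G∈E₃) ; G (there G∈L) G∈E₃ → covers G G∈L G∈E₃ }
      ... | P , covers | inj₂ (inj₁ (_ , F∩M≡X , _)) =
        P , λ { G (here refl) G∈E₃ → ⊥-elim (X⊆F⇒∉E₃ (E₂⇒X⊆F F∩M≡X) G∈E₃) ; G (there G∈L) G∈E₃ → covers G G∈L G∈E₃ }

  removeAll-missing⊆members : (P : List E₃Member) → ListsE₃Members P → (xs : List (Fin n)) →
    (∀ {p} → p ∈ᶠ P → missing p ∈ᶠ xs) → ∀ F → F ∈ᶠ 𝓕 → removeAll X xs ⊆ F
  removeAll-missing⊆members P covers xs missing∈xs F F∈𝓕 z∈ with ∈-removeAll⁻ X xs z∈ | 𝓕⊆H₁ F F∈𝓕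
  ... | z∈X , _ | inj₁ (_ , X⊆F , _) = X⊆F z∈X
  ... | z∈X , _ | inj₂ (inj₁ (_ , F∩M≡X , _)) = E₂⇒X⊆F F∩M≡X z∈X
  ... | z∈X , z∉xs | inj₂ (inj₂ F∈E₃) with find (covers F F∈𝓕 F∈E₃)
  ... | p , p∈P , refl =
    proj₂ (proj₂ (E₃Shape.M∖F≐⁅missing⁆ (shape p))) (X⊆M z∈X) (λ { refl → z∉xs (missing∈xs p∈P) })

  short-missing-list⇒Trivial : ∀ {t} (P : List E₃Member) → ListsE₃Members P → (xs : List (Fin n)) →
    (∀ {p} → p ∈ᶠ P → missing p ∈ᶠ xs) → t + length xs ≤ ∣ X ∣ → Trivial t 𝓕
  short-missing-list⇒Trivial {t} P covers xs missing∈xs t+∣xs∣≤∣X∣ =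
    T , ∣T∣≡t , λ F F∈𝓕 → removeAll-missing⊆members P covers xs missing∈xs F F∈𝓕 ∘ T⊆core
    where
      t≤∣core∣ : t ≤ ∣ removeAll X xs ∣
      t≤∣core∣ = +-cancelʳ-≤ (length xs) t _ (≤-trans t+∣xs∣≤∣X∣ (∣p∣≤∣removeAll∣+length X xs))
      T : Subset n
      T = proj₁ (∃-⊆-of-size (removeAll X xs) t t≤∣core∣)
      T⊆core : T ⊆ removeAll X xs
      T⊆core = proj₁ (proj₂ (∃-⊆-of-size (removeAll X xs) t t≤∣core∣))
      ∣T∣≡t : ∣ T ∣ ≡ t
      ∣T∣≡t = proj₂ (proj₂ (∃-⊆-of-size (removeAll X xs) t t≤∣core∣))

  DistinctMissing : List E₃Member → Set
  DistinctMissing = AllPairs (λ p q → missing p ≢ missing q)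

  TwoExtras : List E₃Member → Set
  TwoExtras Q = ∃₂ λ p q → p ∈ᶠ Q × q ∈ᶠ Q × extra p ≢ extra q

  -- Outside M the sets of Q share no point, so the intersection lies in X minus the missing points.
  ∣⋂∣+length≤∣X∣ : ∀ {G₀} → G₀ ∩ M ≡ X → (Q : List E₃Member) → DistinctMissing Q → TwoExtras Q →
                  ∣ ⋂ (G₀ ∷ map set Q) ∣ + length Q ≤ ∣ X ∣
  ∣⋂∣+length≤∣X∣ {G₀} G₀∩M≡X Q distinct (p , q , p∈Q , q∈Q , extra≢) = begin
    ∣ ⋂ (G₀ ∷ map set Q) ∣ + length Q                        ≤⟨ +-monoˡ-≤ (length Q) (p⊆q⇒∣p∣≤∣q∣ ⋂⊆core) ⟩
    ∣ removeAll X (map missing Q) ∣ + length Q               ≡⟨ cong (∣ removeAll X (map missing Q) ∣ +_)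
                                                                  (length-map missing Q) ⟨
    ∣ removeAll X (map missing Q) ∣ + length (map missing Q) ≡⟨ ∣removeAll∣+length≡∣p∣ X (map missing Q)
                                                                  (AllPairsₚ.map⁺ distinct)
                                                                  (Allₚ.map⁺ (All.tabulate (λ {r} _ → E₃Shape.missing∈X (shape r)))) ⟩
    ∣ X ∣                                                    ∎
    where
      open ≤-Reasoning
      ⋂⊆core : ⋂ (G₀ ∷ map set Q) ⊆ removeAll X (map missing Q)
      ⋂⊆core {z} z∈ with x∈⋂⁻ (G₀ ∷ map set Q) z∈ | z ∈? M
      ... | z∈G₀ ∷ z∈sets | yes z∈M =
        ∈-removeAll⁺ X (map missing Q) (subst (_ ∈_) G₀∩M≡X (x∈p∩q⁺ (z∈G₀ , z∈M))) z∉missings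
        where
          z∉missings : ¬ z ∈ᶠ map missing Q
          z∉missings z∈ with ∈-map⁻ missing z∈
          ... | r , r∈Q , refl = proj₁ (proj₂ (E₃Shape.M∖F≐⁅missing⁆ (shape r))) (All.lookup (Allₚ.map⁻ z∈sets) r∈Q)
      ... | _ ∷ z∈sets | no z∉M = ⊥-elim (extra≢ (trans (sym (z≡extra p∈Q)) (z≡extra q∈Q)))
        where
          z≡extra : ∀ {r} → r ∈ᶠ Q → z ≡ extra r
          z≡extra {r} r∈Q = ∖≐⁅⁆⇒≡ (E₃Shape.F∖M≐⁅extra⁆ (shape r)) (All.lookup (Allₚ.map⁻ z∈sets) r∈Q) z∉M

  Tuple : ℕ → Set
  Tuple r′ = Σ (List E₃Member) λ Q → length Q ≡ r′ × DistinctMissing Q × TwoExtras Q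

  prefix-Tuple : ∀ s p q rest → DistinctMissing (p ∷ q ∷ rest) → s ≤ length rest → extra p ≢ extra q →
                 Tuple (2 + s)
  prefix-Tuple s p q rest distinct s≤∣rest∣ extra≢ =
    p ∷ q ∷ take s rest , cong (2 +_) (trans (length-take s rest) (m≤n⇒m⊓n≡m s≤∣rest∣)) ,
    AllPairsₚ.take⁺ (2 + s) distinct , p , q , here refl , there (here refl) , extra≢

  private
    missing≟ : (p q : E₃Member) → Dec (missing p ≡ missing q)
    missing≟ p q = missing p Data.Fin.≟ missing q

    dedup : List E₃Member → List E₃Member
    dedup = deduplicate missing≟

  -- dedup (p₀ ∷ p₁ ∷ P) starts with p₀, followed by p₁ unless p₁ has the same missing point as p₀;
  -- in that case p₁ can replace p₀ in front of the remaining list.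
  Tuple-from-two-extras : ∀ s p₀ p₁ P → extra p₀ ≢ extra p₁ → 2 + s ≤ length (dedup (p₀ ∷ p₁ ∷ P)) →
                          Tuple (2 + s)
  Tuple-from-two-extras s p₀ p₁ P extra≢ 2+s≤∣D∣ = by-cases (missing p₀ Data.Fin.≟ missing p₁)
    where
      shared : missing p₀ ≡ missing p₁ → ∀ D′ → DistinctMissing (p₀ ∷ D′) → 2 + s ≤ length (p₀ ∷ D′) →
               Tuple (2 + s)
      shared _ [] _ (s≤s ())
      shared missing≡ (e ∷ rest) distinct@(p₀∉ ∷ distinct′) (s≤s (s≤s s≤∣rest∣)) with extra p₀ Data.Fin.≟ extra e
      ... | no extra≢e = prefix-Tuple s p₀ e rest distinct s≤∣rest∣ extra≢e
      ... | yes extra≡e = prefix-Tuple s p₁ e rest (All.map (_∘ trans missing≡) p₀∉ ∷ distinct′) s≤∣rest∣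
                                       (λ p₁≡e → extra≢ (trans extra≡e (sym p₁≡e)))

      by-cases : Dec (missing p₀ ≡ missing p₁) → Tuple (2 + s)
      by-cases (no missing≢) =
        let rest , D≡ = deduplicate-∷-∷ missing≟ P missing≢
        in prefix-Tuple s p₀ p₁ rest (subst DistinctMissing D≡ (deduplicate-AllPairs missing≟ (p₀ ∷ p₁ ∷ P)))
                        (s≤s⁻¹ (s≤s⁻¹ (subst ((2 + s ≤_) ∘ length) D≡ 2+s≤∣D∣))) extra≢
      by-cases (yes missing≡) = shared missing≡ _ (deduplicate-AllPairs missing≟ (p₀ ∷ p₁ ∷ P)) 2+s≤∣D∣

  module _ (M⊆C : M ⊆ C) {G₀ : Subset n} (G₀∈𝓕 : G₀ ∈ᶠ 𝓕) (G₀∩M≡X : G₀ ∩ M ≡ X)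
           {t s : ℕ} (∣X∣≡t+1+s : ∣ X ∣ ≡ t + suc s)
           (rw : RWiseTIntersecting (3 + s) t 𝓕) (nt : NonTrivial t 𝓕) where

    private
      1+∣X∣≡t+r∸1 : suc ∣ X ∣ ≡ t + (3 + s) ∸ 1
      1+∣X∣≡t+r∸1 = sym (trans (cong (_∸ 1) (+-suc t (2 + s))) (trans (+-suc t (suc s)) (cong suc (sym ∣X∣≡t+1+s))))

    Tuple⇒⊥ : ¬ Tuple (2 + s)
    Tuple⇒⊥ (Q , ∣Q∣≡2+s , distinct , twoExtras) = 1+n≰n (begin
      suc ∣ X ∣                          ≡⟨ cong suc ∣X∣≡t+1+s ⟩
      suc (t + suc s)                    ≡⟨ +-suc t (suc s) ⟨
      t + (2 + s)                        ≤⟨ +-mono-≤ t≤∣⋂∣ (≤-reflexive (sym ∣Q∣≡2+s)) ⟩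
      ∣ ⋂ (G₀ ∷ map set Q) ∣ + length Q   ≤⟨ ∣⋂∣+length≤∣X∣ G₀∩M≡X Q distinct twoExtras ⟩
      ∣ X ∣                              ∎)
      where
        open ≤-Reasoning
        rw′ : RWiseTIntersecting (length (G₀ ∷ map set Q)) t 𝓕
        rw′ = subst (λ m → RWiseTIntersecting (suc m) t 𝓕) (sym (trans (length-map set Q) ∣Q∣≡2+s)) rw
        t≤∣⋂∣ : t ≤ ∣ ⋂ (G₀ ∷ map set Q) ∣
        t≤∣⋂∣ = RWiseTIntersecting⇒t≤∣⋂∣ (G₀ ∷ map set Q) rw′
                  (G₀∈𝓕 ∷ Allₚ.map⁺ (All.tabulate (λ {p} _ → set∈𝓕 p)))

    extras-agree : (p₀ p₁ : E₃Member) → extra p₀ ≡ extra p₁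
    extras-agree p₀ p₁ = decidable-stable (extra p₀ Data.Fin.≟ extra p₁) extras≢⇒⊥
      where
        P D : List E₃Member
        P = proj₁ ∃-ListsE₃Members
        D = dedup (p₀ ∷ p₁ ∷ P)

        missing∈D : ∀ {p} → p ∈ᶠ P → missing p ∈ᶠ map missing D
        missing∈D p∈P = Anyₚ.map⁺ (Anyₚ.deduplicate⁺ missing≟ {xs = p₀ ∷ p₁ ∷ P} (λ e pr → trans pr (sym e))
                                     (there (there (Any.map (cong missing) p∈P))))

        few : ¬ (2 + s ≤ length D) → t + length (map missing D) ≤ ∣ X ∣
        few D-short = begin
          t + length (map missing D) ≡⟨ cong (t +_) (length-map missing D) ⟩
          t + length D               ≤⟨ +-monoʳ-≤ t (s≤s⁻¹ (≰⇒> D-short)) ⟩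
          t + suc s                  ≡⟨ ∣X∣≡t+1+s ⟨
          ∣ X ∣                      ∎
          where open ≤-Reasoning

        extras≢⇒⊥ : ¬ extra p₀ ≢ extra p₁
        extras≢⇒⊥ extra≢ with 2 + s ≤? length D
        ... | yes D-long = Tuple⇒⊥ (Tuple-from-two-extras s p₀ p₁ P extra≢ D-long)
        ... | no D-short = nt (short-missing-list⇒Trivial P (proj₂ ∃-ListsE₃Members) (map missing D)
                                 missing∈D (few D-short))

    H₁-family⇒H-family : Σ (Subset n) λ M′ → M′ ⊆ C × ∣ M′ ∣ ≡ k + 1 × M ⊆ M′ ×
                                            (∀ F → F ∈ᶠ 𝓕 → InH k (t + (3 + s) ∸ 1) X M′ F)
    H₁-family⇒H-family with ∃-ListsE₃Members
    ... | [] , covers = ⊥-elim (nt (short-missing-list⇒Trivial [] covers [] (λ ())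
                                      (≤-trans (+-monoʳ-≤ t z≤n) (≤-reflexive (sym ∣X∣≡t+1+s)))))
    ... | p₀ ∷ _ , _ =
      M ∪ ⁅ y₀ ⁆ , M∪⁅y₀⁆⊆C , ∣M∪⁅y₀⁆∣≡k+1 , p⊆p∪q ⁅ y₀ ⁆ ,
      λ F F∈𝓕 → subst (λ d → InH k d X (M ∪ ⁅ y₀ ⁆) F) 1+∣X∣≡t+r∸1
                  (InH₁⇒InH[M∪⁅y⁆] M⊆C ∣M∣≡k X⊆M y₀∈C y₀∉M (𝓕⊆H₁ F F∈𝓕) (F∈E₃⇒F⊆M∪⁅y₀⁆ F∈𝓕))
      where
        y₀ : Fin n
        y₀ = extra p₀
        y₀∈C : y₀ ∈ C
        y₀∈C = proj₁ (proj₂ (set∈E₃ p₀)) (proj₁ (E₃Shape.F∖M≐⁅extra⁆ (shape p₀)))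
        y₀∉M : y₀ ∉ M
        y₀∉M = proj₁ (proj₂ (E₃Shape.F∖M≐⁅extra⁆ (shape p₀)))
        M∪⁅y₀⁆⊆C : M ∪ ⁅ y₀ ⁆ ⊆ C
        M∪⁅y₀⁆⊆C z∈ with x∈p∪q⁻ M ⁅ y₀ ⁆ z∈
        ... | inj₁ z∈M = M⊆C z∈M
        ... | inj₂ z∈⁅y₀⁆ = subst (_∈ C) (sym (x∈⁅y⁆⇒x≡y y₀ z∈⁅y₀⁆)) y₀∈C
        ∣M∪⁅y₀⁆∣≡k+1 : ∣ M ∪ ⁅ y₀ ⁆ ∣ ≡ k + 1
        ∣M∪⁅y₀⁆∣≡k+1 = trans (x∉p⇒∣p∪⁅x⁆∣≡1+∣p∣ M y₀ y₀∉M) (trans (cong suc ∣M∣≡k) (+-comm 1 k))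
        F∈E₃⇒F⊆M∪⁅y₀⁆ : ∀ {F} → F ∈ᶠ 𝓕 → InE₃ k ∣ X ∣ X M C F → F ⊆ M ∪ ⁅ y₀ ⁆
        F∈E₃⇒F⊆M∪⁅y₀⁆ F∈𝓕 F∈E₃ =
          let p : E₃Member
              p = record { set = _ ; set∈𝓕 = F∈𝓕 ; set∈E₃ = F∈E₃ }
          in subst (λ y → _ ⊆ M ∪ ⁅ y ⁆) (extras-agree p p₀) (∖≐⁅⁆⇒⊆∪⁅⁆ (E₃Shape.F∖M≐⁅extra⁆ (shape p)))

lemma2p9 : (n k t r : ℕ) → 1 ≤ n → 1 ≤ k → 1 ≤ t → 3 ≤ r →
    t + r ∸ 2 ≤ k ∸ 2 → 2 * k + t + r + 2 ≤ n →
    (X M C : Subset n) → X ⊆ M → M ⊆ C →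
    ∣ X ∣ ≡ t + r ∸ 2 → ∣ M ∣ ≡ k →
    k + 2 ≤ ∣ C ∣ → ∣ C ∣ + t + r ≤ 2 * k + 2 →
    (𝓕 : Family n) → Unique 𝓕 →
    (∀ F → F ∈ᶠ 𝓕 → InH₁ k X M C F) →
    RWiseTIntersecting r t 𝓕 → NonTrivial t 𝓕 →
    h₁ (t + r ∸ 2) k n < length 𝓕 →
    Σ (Subset n) λ M′ → M′ ⊆ C × ∣ M′ ∣ ≡ k + 1 × M ⊆ M′ ×
    (∀ F → F ∈ᶠ 𝓕 → InH k (t + r ∸ 1) X M′ F)
lemma2p9 n k t .(3 + s) _ _ 1≤t (s≤s (s≤s (s≤s {n = s} z≤n))) _ _ X M C X⊆M M⊆C ∣X∣≡t+r∸2 ∣M∣≡k _ _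
         𝓕 𝓕-unique 𝓕⊆H₁ rw nt h₁<∣𝓕∣ = by-cases (middle⊎sides 𝓕 𝓕⊆H₁)
  where
    ∣X∣≡t+1+s : ∣ X ∣ ≡ t + suc s
    ∣X∣≡t+1+s = trans ∣X∣≡t+r∸2 (cong (_∸ 2) (trans (+-suc t (2 + s)) (cong suc (+-suc t (suc s)))))
    1≤∣X∣ : 1 ≤ ∣ X ∣
    1≤∣X∣ = subst (1 ≤_) (sym ∣X∣≡t+1+s) (≤-trans 1≤t (m≤m+n t (suc s)))

    by-cases : (∃ λ G → G ∈ᶠ 𝓕 × InE₂ k ∣ X ∣ ∣ C ∣ X M C G) ⊎
               (∀ F → F ∈ᶠ 𝓕 → InE₁ k (∣ X ∣) X M F ⊎ InE₃ k (∣ X ∣) X M C F) →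
               Σ (Subset n) λ M′ → M′ ⊆ C × ∣ M′ ∣ ≡ k + 1 × M ⊆ M′ ×
                                   (∀ F → F ∈ᶠ 𝓕 → InH k (t + (3 + s) ∸ 1) X M′ F)
    by-cases (inj₂ 𝓕⊆E₁∪E₃) = ⊥-elim (<⇒≱ h₁<∣𝓕∣ (subst (λ d → length 𝓕 ≤ h₁ d k n) ∣X∣≡t+r∸2
                                (length≤h₁ X⊆M 1≤∣X∣ ∣M∣≡k 𝓕 𝓕-unique 𝓕⊆E₁∪E₃)))
    by-cases (inj₁ (G₀ , G₀∈𝓕 , _ , G₀∩M≡X , _)) =
      H₁-family⇒H-family X⊆M 1≤∣X∣ ∣M∣≡k 𝓕⊆H₁ M⊆C G₀∈𝓕 G₀∩M≡X ∣X∣≡t+1+s rw nt
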